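{- For every integer $t\geq 1$, the $3$-rainbow index of the complete bipartite graph $K_{2,t}$ is \[ rx_3(K_{2,t})=\begin{cases} 2, & \text{if } t=1,2;\\ 3, & \text{if } t=3,4;\\ 4, & \text{if } 5\leq t\leq 8;\\ 5, & \text{if } 9\leq t\leq 20;\\ k, & \text{if } (k-1)(k-2)+1\leq t\leq k(k-1) \text{ for an integer } k\geq 6. \end{cases} \]
   Context: All graphs are simple, finite and undirected. Let $G$ be a connected graph on which an edge coloring is defined (adjacent edges may receive the same color). A tree $T$ in $G$ is a rainbow tree if no two edges of $T$ have the same color. For a vertex subset $S\subseteq V(G)$, an $S$-tree is a tree in $G$ containing all vertices of $S$. For an integer $k\geq 2$ not exceeding the number of vertices of $G$, a $k$-rainbow coloring of $G$ is an edge coloring such that for every set $S$ of $k$ vertices of $G$ there exists a rainbow $S$-tree in $G$. The $k$-rainbow index $rx_k(G)$ is the minimum number of colors needed in a $k$-rainbow coloring of $G$. $K_{2,t}$ denotes the complete bipartite graph with parts of sizes $2$ and $t$. -}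

module Defs where

open import Data.Nat using (ℕ; _+_; _*_; _∸_; _≤_; _<_; suc)
open import Data.Fin using (Fin; toℕ)
open import Data.Fin.Subset using (Subset; ∣_∣) renaming (_∈_ to _∈ₛ_)
open import Data.List using (List; []; _∷_; map)
open import Data.List.Membership.Propositional using (_∈_; _∉_)
open import Data.List.Relation.Unary.Unique.Propositional using (Unique)
open import Data.Product using (Σ; _×_; _,_; proj₁; proj₂; ∃)
open import Data.Sum using (_⊎_)
open import Relation.Binary.PropositionalEquality using (_≡_)
open import Relation.Nullary using (¬_)

record Graph (n : ℕ) : Set₁ where
  field
    Adj   : Fin n → Fin n → Set
    sym   : ∀ {u v} → Adj u v → Adj v u
    irrefl : ∀ {u} → ¬ Adj u u
open Graph public

-- Edge colouring of G with (at most) m colours: a colour for every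
-- (unordered) pair, symmetric; only its values on edges matter.
record EdgeColouring {n : ℕ} (G : Graph n) (m : ℕ) : Set where
  field
    col  : Fin n → Fin n → Fin m
    colSym : ∀ u v → col u v ≡ col v u
open EdgeColouring public

-- Trees in G, given by their vertex list and edge list, built inductively:
-- a single vertex is a tree; attaching a new vertex w by an edge of G to a
-- vertex u of a tree gives a tree.  (Every finite tree arises this way.)
data IsTree {n : ℕ} (G : Graph n) : List (Fin n) → List (Fin n × Fin n) → Set where
  single : (v : Fin n) → IsTree G (v ∷ []) []
  grow   : ∀ {vs es u w} → IsTree G vs es → u ∈ vs → w ∉ vs → Adj G u w →
           IsTree G (w ∷ vs) ((u , w) ∷ es)

IsRainbow : ∀ {n m} {G : Graph n} → EdgeColouring G m → List (Fin n × Fin n) → Set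
IsRainbow c es = Unique (map (λ e → col c (proj₁ e) (proj₂ e)) es)

HasRainbowSTree : ∀ {n m} (G : Graph n) → EdgeColouring G m → Subset n → Set
HasRainbowSTree {n} G c S =
  Σ (List (Fin n)) λ vs → Σ (List (Fin n × Fin n)) λ es →
    IsTree G vs es × IsRainbow c es × (∀ v → v ∈ₛ S → v ∈ vs)

IsKRainbowColouring : ∀ {n m} (G : Graph n) (k : ℕ) → EdgeColouring G m → Set
IsKRainbowColouring {n} G k c = (S : Subset n) → ∣ S ∣ ≡ k → HasRainbowSTree G c S

RainbowIndex : ∀ {n} (G : Graph n) (k r : ℕ) → Set
RainbowIndex G k r =
  (Σ (EdgeColouring G r) λ c → IsKRainbowColouring G k c) ×
  (∀ m → (c : EdgeColouring G m) → IsKRainbowColouring G k c → r ≤ m)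

K2 : (t : ℕ) → Graph (2 + t)
K2 t = record
  { Adj = λ u v → (toℕ u < 2 × 2 ≤ toℕ v) ⊎ (2 ≤ toℕ u × toℕ v < 2)
  ; sym = symm
  ; irrefl = irr
  }
  where
  open import Data.Sum using (inj₁; inj₂)
  open import Data.Nat.Properties using (<⇒≱)
  symm : ∀ {u v : Fin (2 + t)} → (toℕ u < 2 × 2 ≤ toℕ v) ⊎ (2 ≤ toℕ u × toℕ v < 2)
       → (toℕ v < 2 × 2 ≤ toℕ u) ⊎ (2 ≤ toℕ v × toℕ u < 2)
  symm (inj₁ (a , b)) = inj₂ (b , a)
  symm (inj₂ (a , b)) = inj₁ (b , a)
  irr : ∀ {u : Fin (2 + t)} → ¬ ((toℕ u < 2 × 2 ≤ toℕ u) ⊎ (2 ≤ toℕ u × toℕ u < 2))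
  irr (inj₁ (a , b)) = <⇒≱ a b
  irr (inj₂ (a , b)) = <⇒≱ b a

module Submission where

-- Write X i and Y i for the colours of the edges from leaf i to the centres A and B. A rainbow
-- tree through three leaves uses a different colour at each of them, and one through A, B and a
-- leaf passes through a leaf l with X l ≢ Y l. Together these let the leaves be sent injectively
-- to ordered pairs of distinct colours, so t ≤ m (m - 1) for m colours; for three and four colours
-- an exhaustive search over the possible colour pairs of the leaves sharpens this to t ≤ 4 and
-- t ≤ 8. Conversely, distinct off-diagonal pairs (X i , Y i) give a 3-rainbow colouring as soon
-- as every triangle of leaves (a , b), (a , c), (c , b) has a leaf with both colours outside
-- {a, b, c}; explicit tables for two to five colours, and the list of all off-diagonal pairs for
-- k ≥ 6 colours, have this property for every prefix of the required length.

open import Defs hiding (sym)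

open import Data.Bool using (Bool; true; false; T; not; _∧_; _∨_)
open import Data.Bool.ListAction using (all)
open import Data.Bool.Properties using (T-∧)
open import Data.Empty using (⊥; ⊥-elim)
open import Data.Fin using (Fin; zero; suc; toℕ; #_; inject≤; fromℕ<; combine; remQuot; punchIn; punchOut)
  renaming (_≤?_ to _≤ᶠ?_)
open import Data.Fin.Properties
  using (_≟_; ¬Fin0; suc-injective; toℕ-injective; toℕ<n; toℕ-fromℕ<; toℕ-inject≤; inject≤-injective;
         combine-injective; combine-remQuot; remQuot-combine; toℕ-combine; punchIn-injective; punchInᵢ≢i;
         punchOut-injective; injective⇒≤; pigeonhole; any?; all?; ≤-decTotalOrder)
open import Data.Fin.Subset using (Subset; ∣_∣; ⁅_⁆; _∪_; inside; outside) renaming (_∈_ to _∈ₛ_; _∉_ to _∉ₛ_)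
open import Data.Fin.Subset.Properties using (x∈p∪q⁻; x∈p∪q⁺; x∈⁅x⁆; x∈⁅y⁆⇒x≡y; ∣⁅x⁆∣≡1; ∪-identityˡ)
open import Data.List using (List; []; _∷_; map; length; lookup; allFin; reverse; _ʳ++_)
open import Data.List.Properties
  using (length-map; length-reverse; length-tabulate; ʳ++-defn; ++-identityʳ; reverse-involutive)
open import Data.List.Membership.Propositional using (_∈_; _∉_)
open import Data.List.Membership.Propositional.Properties using (∈-map⁺; ∈-lookup; ∈-allFin)
open import Data.List.Relation.Unary.All using (All; []; _∷_)
import Data.List.Relation.Unary.All as All
open import Data.List.Relation.Unary.All.Properties using (¬Any⇒All¬; All¬⇒¬Any; all⁺) renaming (map⁺ to All-map⁺)
open import Data.List.Relation.Unary.AllPairs using (AllPairs; []; _∷_; allPairs?)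
open import Data.List.Relation.Unary.Any using (here; there)
import Data.List.Relation.Unary.Any as Any
open import Data.List.Relation.Unary.Linked as Linked using (_∷_)
open import Data.List.Relation.Unary.Unique.Propositional using (Unique)
import Data.List.Relation.Unary.Unique.Propositional.Properties as Unique
open import Data.List.Relation.Binary.Permutation.Propositional as ↭ using (_↭_; ↭-sym; ↭⇒↭ₛ)
open import Data.List.Relation.Binary.Permutation.Propositional.Properties using (All-resp-↭; ↭-length)
import Data.List.Relation.Binary.Permutation.Setoid.Properties as PermutationSetoid
open import Data.Nat using (ℕ; zero; suc; _+_; _*_; _∸_; _⊔_; _≤_; _<_; z≤n; s≤s; _≤′_; ≤′-refl; ≤′-step)
open import Data.Nat.Properties
  using (≤-refl; ≤-trans; <-trans; <-≤-trans; <-irrefl; <-cmp; _≤?_; _<?_; ≰⇒>; <⇒≱; ≤-pred; ≤⇒≤′;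
         m≤m+n; m≤m⊔n; ⊔-lub; n≤1+n; m≤n⇒m≤1+n; +-comm; +-mono-≤; *-mono-≤; *-monoʳ-≤; module ≤-Reasoning)
open import Data.Nat.Tactic.RingSolver using (solve-∀)
open import Data.Product using (Σ; _×_; _,_; proj₁; proj₂; uncurry)
open import Data.Product.Properties using (≡-dec)
open import Data.Sum using (_⊎_; inj₁; inj₂)
open import Data.Unit using (⊤; tt)
open import Data.Vec using (Vec; []; _∷_; here; there)
import Data.Vec as Vec
open import Function using (_∘_; flip)
open import Function.Bundles using (Equivalence)
open import Relation.Binary using (tri<; tri≈; tri>)
open import Relation.Binary.Bundles using (DecTotalOrder)
open import Relation.Binary.PropositionalEquality
  using (_≡_; _≢_; refl; sym; trans; cong; cong₂; subst; subst₂; resp₂; setoid; module ≡-Reasoning)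
open import Relation.Nullary using (¬_; ¬?; yes; no; Dec)
open import Relation.Nullary.Decidable using (_×-dec_; _⊎-dec_; _→-dec_; ⌊_⌋; fromWitness; from-yes; map′)

private variable
  n : ℕ

triple : Fin n → Fin n → Fin n → Subset n
triple u v w = ⁅ u ⁆ ∪ ⁅ v ⁆ ∪ ⁅ w ⁆

∣⁅x⁆∪p∣≡1+∣p∣ : (x : Fin n) (p : Subset n) → x ∉ₛ p → ∣ ⁅ x ⁆ ∪ p ∣ ≡ suc ∣ p ∣
∣⁅x⁆∪p∣≡1+∣p∣ zero    (inside  ∷ p) x∉p = ⊥-elim (x∉p here)
∣⁅x⁆∪p∣≡1+∣p∣ zero    (outside ∷ p) x∉p = cong (suc ∘ ∣_∣) (∪-identityˡ p)
∣⁅x⁆∪p∣≡1+∣p∣ (suc x) (inside  ∷ p) x∉p = cong suc (∣⁅x⁆∪p∣≡1+∣p∣ x p (x∉p ∘ there))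
∣⁅x⁆∪p∣≡1+∣p∣ (suc x) (outside ∷ p) x∉p = ∣⁅x⁆∪p∣≡1+∣p∣ x p (x∉p ∘ there)

∣triple∣≡3 : {u v w : Fin n} → u ≢ v → u ≢ w → v ≢ w → ∣ triple u v w ∣ ≡ 3
∣triple∣≡3 {u = u} {v} {w} u≢v u≢w v≢w = begin
  ∣ ⁅ u ⁆ ∪ ⁅ v ⁆ ∪ ⁅ w ⁆ ∣  ≡⟨ ∣⁅x⁆∪p∣≡1+∣p∣ u _ u∉ ⟩
  suc ∣ ⁅ v ⁆ ∪ ⁅ w ⁆ ∣     ≡⟨ cong suc (∣⁅x⁆∪p∣≡1+∣p∣ v _ (v≢w ∘ x∈⁅y⁆⇒x≡y w)) ⟩
  suc (suc ∣ ⁅ w ⁆ ∣)       ≡⟨ cong (λ k → 2 + k) (∣⁅x⁆∣≡1 w) ⟩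
  3                         ∎
  where
  open ≡-Reasoning
  u∉ : u ∉ₛ ⁅ v ⁆ ∪ ⁅ w ⁆
  u∉ u∈ with x∈p∪q⁻ ⁅ v ⁆ ⁅ w ⁆ u∈
  ... | inj₁ u∈v = u≢v (x∈⁅y⁆⇒x≡y v u∈v)
  ... | inj₂ u∈w = u≢w (x∈⁅y⁆⇒x≡y w u∈w)

∈triple₁ : (u v w : Fin n) → u ∈ₛ triple u v w
∈triple₁ u v w = x∈p∪q⁺ (inj₁ (x∈⁅x⁆ u))

∈triple₂ : (u v w : Fin n) → v ∈ₛ triple u v w
∈triple₂ u v w = x∈p∪q⁺ (inj₂ (x∈p∪q⁺ (inj₁ (x∈⁅x⁆ v))))

∈triple₃ : (u v w : Fin n) → w ∈ₛ triple u v w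
∈triple₃ u v w = x∈p∪q⁺ (inj₂ (x∈p∪q⁺ (inj₂ (x∈⁅x⁆ w))))

elements : Subset n → List (Fin n)
elements []            = []
elements (inside  ∷ p) = zero ∷ map suc (elements p)
elements (outside ∷ p) = map suc (elements p)

length-elements : (p : Subset n) → length (elements p) ≡ ∣ p ∣
length-elements []            = refl
length-elements (inside  ∷ p) = cong suc (trans (length-map suc (elements p)) (length-elements p))
length-elements (outside ∷ p) = trans (length-map suc (elements p)) (length-elements p)

∈⇒∈elements : (p : Subset n) {x : Fin n} → x ∈ₛ p → x ∈ elements p
∈⇒∈elements (inside  ∷ p) here      = here refl
∈⇒∈elements (inside  ∷ p) (there h) = there (∈-map⁺ suc (∈⇒∈elements p h))
∈⇒∈elements (outside ∷ p) (there h) = ∈-map⁺ suc (∈⇒∈elements p h)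

elements-unique : (p : Subset n) → Unique (elements p)
elements-unique []            = []
elements-unique (inside  ∷ p) =
  ¬Any⇒All¬ _ zero∉ ∷ Unique.map⁺ suc-injective (elements-unique p)
  where
  zero∉ : ∀ {xs : List (Fin _)} → zero ∉ map suc xs
  zero∉ {_ ∷ _} (here ())
  zero∉ {_ ∷ _} (there h) = zero∉ h
elements-unique (outside ∷ p) = Unique.map⁺ suc-injective (elements-unique p)

record ThreeElements (S : Subset n) : Set where
  field
    u v w : Fin n
    u≢v   : u ≢ v
    u≢w   : u ≢ w
    v≢w   : v ≢ w
    cover : ∀ x → x ∈ₛ S → x ≡ u ⊎ x ≡ v ⊎ x ≡ w

∣S∣≡3⇒threeElements : (S : Subset n) → ∣ S ∣ ≡ 3 → ThreeElements S
∣S∣≡3⇒threeElements S ∣S∣≡3 =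
  fromList (elements S) (trans (length-elements S) ∣S∣≡3) (∈⇒∈elements S) (elements-unique S)
  where
  fromList : (xs : List (Fin _)) → length xs ≡ 3 → (∀ {x} → x ∈ₛ S → x ∈ xs) → Unique xs → ThreeElements S
  fromList (u ∷ v ∷ w ∷ []) _ complete ((u≢v ∷ u≢w ∷ []) ∷ (v≢w ∷ []) ∷ _) = record
    { u = u ; v = v ; w = w ; u≢v = u≢v ; u≢w = u≢w ; v≢w = v≢w ; cover = cover }
    where
    cover : ∀ x → x ∈ₛ S → x ≡ u ⊎ x ≡ v ⊎ x ≡ w
    cover x x∈S with complete x∈S
    ... | here x≡u                 = inj₁ x≡u
    ... | there (here x≡v)         = inj₂ (inj₁ x≡v)
    ... | there (there (here x≡w)) = inj₂ (inj₂ x≡w)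

Touches : Fin n → Fin n × Fin n → Set
Touches v e = proj₁ e ≡ v ⊎ proj₂ e ≡ v

module _ {G : Graph n} where

  tree-edge⇒Adj : ∀ {vs es u w} → IsTree G vs es → (u , w) ∈ es → Adj G u w
  tree-edge⇒Adj (grow T _ _ adj) (here refl) = adj
  tree-edge⇒Adj (grow T _ _ _)   (there e∈)  = tree-edge⇒Adj T e∈

  tree-edge⇒ends∈ : ∀ {vs es u w} → IsTree G vs es → (u , w) ∈ es → u ∈ vs × w ∈ vs
  tree-edge⇒ends∈ (grow T u∈ _ _) (here refl) = there u∈ , here refl
  tree-edge⇒ends∈ (grow T _ _ _)  (there e∈)  =
    let u∈ , w∈ = tree-edge⇒ends∈ T e∈ in there u∈ , there w∈

  incident-edge : ∀ {vs es v u} → IsTree G vs es → v ∈ vs → u ∈ vs → v ≢ u →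
                  Σ (Fin n × Fin n) λ e → e ∈ es × Touches v e
  incident-edge (single _) (here refl) (here refl) v≢u = ⊥-elim (v≢u refl)
  incident-edge (grow {u = u₀} {w} T _ _ _) (here refl) _ _ = (u₀ , w) , here refl , inj₂ refl
  incident-edge {v = v} (grow {u = u₀} {w} T u₀∈ _ _) (there v∈) (here refl) _ with v ≟ u₀
  ... | yes refl = (u₀ , w) , here refl , inj₁ refl
  ... | no v≢u₀  = let e , e∈ , touch = incident-edge T v∈ u₀∈ v≢u₀ in e , there e∈ , touch
  incident-edge (grow T _ _ _) (there v∈) (there u∈) v≢u =
    let e , e∈ , touch = incident-edge T v∈ u∈ v≢u in e , there e∈ , touch

map-Unique-injective : {X Y : Set} (f : X → Y) {xs : List X} {x y : X} →
                       Unique (map f xs) → x ∈ xs → y ∈ xs → f x ≡ f y → x ≡ y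
map-Unique-injective f (_ ∷ _)   (here refl) (here refl) _ = refl
map-Unique-injective f (f∉ ∷ _)  (here refl) (there y∈) fx≡fy = ⊥-elim (All.lookup f∉ (∈-map⁺ f y∈) fx≡fy)
map-Unique-injective f (f∉ ∷ _)  (there x∈) (here refl) fx≡fy = ⊥-elim (All.lookup f∉ (∈-map⁺ f x∈) (sym fx≡fy))
map-Unique-injective f (_ ∷ fxs) (there x∈) (there y∈) fx≡fy = map-Unique-injective f fxs x∈ y∈ fx≡fy

module _ {X : Set} where

  unique₂ : {a b : X} → a ≢ b → Unique (a ∷ b ∷ [])
  unique₂ a≢b = (a≢b ∷ []) ∷ [] ∷ []

  unique₃ : {a b c : X} → a ≢ b → a ≢ c → b ≢ c → Unique (a ∷ b ∷ c ∷ [])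
  unique₃ a≢b a≢c b≢c = (a≢b ∷ a≢c ∷ []) ∷ (b≢c ∷ []) ∷ [] ∷ []

  unique₄ : {a b c d : X} → a ≢ b → a ≢ c → a ≢ d → b ≢ c → b ≢ d → c ≢ d → Unique (a ∷ b ∷ c ∷ d ∷ [])
  unique₄ a≢b a≢c a≢d b≢c b≢d c≢d = (a≢b ∷ a≢c ∷ a≢d ∷ []) ∷ (b≢c ∷ b≢d ∷ []) ∷ (c≢d ∷ []) ∷ [] ∷ []

  unique₅ : {a b c d e : X} → a ≢ b → a ≢ c → a ≢ d → a ≢ e → b ≢ c → b ≢ d → b ≢ e → c ≢ d → c ≢ e → d ≢ e →
            Unique (a ∷ b ∷ c ∷ d ∷ e ∷ [])
  unique₅ a≢b a≢c a≢d a≢e b≢c b≢d b≢e c≢d c≢e d≢e =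
    (a≢b ∷ a≢c ∷ a≢d ∷ a≢e ∷ []) ∷ (b≢c ∷ b≢d ∷ b≢e ∷ []) ∷ (c≢d ∷ c≢e ∷ []) ∷ (d≢e ∷ []) ∷ [] ∷ []

Unique-lookup-injective : {X : Set} {xs : List X} → Unique xs → ∀ {i j} → lookup xs i ≡ lookup xs j → i ≡ j
Unique-lookup-injective (_ ∷ _)   {zero}  {zero}  _  = refl
Unique-lookup-injective (x∉ ∷ _)  {zero}  {suc j} eq = ⊥-elim (All.lookup x∉ (∈-lookup j) eq)
Unique-lookup-injective (x∉ ∷ _)  {suc i} {zero}  eq = ⊥-elim (All.lookup x∉ (∈-lookup i) (sym eq))
Unique-lookup-injective (_ ∷ xs!) {suc i} {suc j} eq = cong suc (Unique-lookup-injective xs! eq)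

Unique⇒length≤ : {m : ℕ} {xs : List (Fin m)} → Unique xs → length xs ≤ m
Unique⇒length≤ xs! = injective⇒≤ (Unique-lookup-injective xs!)

private variable
  t : ℕ

Vertex : ℕ → Set
Vertex t = Fin (2 + t)

A B : Vertex t
A = zero
B = suc zero

leaf : Fin t → Vertex t
leaf i = suc (suc i)

leaf-injective : {i j : Fin t} → leaf i ≡ leaf j → i ≡ j
leaf-injective = suc-injective ∘ suc-injective

adj-A-leaf : (i : Fin t) → Adj (K2 t) A (leaf i)
adj-A-leaf i = inj₁ (s≤s z≤n , s≤s (s≤s z≤n))

adj-B-leaf : (i : Fin t) → Adj (K2 t) B (leaf i)
adj-B-leaf i = inj₁ (s≤s (s≤s z≤n) , s≤s (s≤s z≤n))

adj-leaf-A : (i : Fin t) → Adj (K2 t) (leaf i) A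
adj-leaf-A i = Graph.sym (K2 _) (adj-A-leaf i)

adj-leaf-B : (i : Fin t) → Adj (K2 t) (leaf i) B
adj-leaf-B i = Graph.sym (K2 _) (adj-B-leaf i)

Centre : Vertex t → Set
Centre w = w ≡ A ⊎ w ≡ B

adj-leaf⇒Centre : {i : Fin t} {w : Vertex t} → Adj (K2 t) (leaf i) w → Centre w
adj-leaf⇒Centre {w = zero}          _ = inj₁ refl
adj-leaf⇒Centre {w = suc zero}      _ = inj₂ refl
adj-leaf⇒Centre {w = suc (suc w)} (inj₁ (s≤s (s≤s ()) , _))
adj-leaf⇒Centre {w = suc (suc w)} (inj₂ (_ , s≤s (s≤s ())))

data EdgeShape {t} : Vertex t → Vertex t → Set where
  centre-leaf : ∀ w i → Centre w → EdgeShape w (leaf i)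
  leaf-centre : ∀ i w → Centre w → EdgeShape (leaf i) w

edgeShape : {u w : Vertex t} → Adj (K2 t) u w → EdgeShape u w
edgeShape {u = zero}          {suc (suc i)} _ = centre-leaf A i (inj₁ refl)
edgeShape {u = suc zero}      {suc (suc i)} _ = centre-leaf B i (inj₂ refl)
edgeShape {u = suc (suc i)}   {w}           a = leaf-centre i w (adj-leaf⇒Centre a)
edgeShape {u = zero}          {zero}        (inj₁ (_ , ()))
edgeShape {u = zero}          {zero}        (inj₂ (() , _))
edgeShape {u = zero}          {suc zero}    (inj₁ (_ , s≤s ()))
edgeShape {u = zero}          {suc zero}    (inj₂ (() , _))
edgeShape {u = suc zero}      {zero}        (inj₁ (_ , ()))
edgeShape {u = suc zero}      {zero}        (inj₂ (s≤s () , _))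
edgeShape {u = suc zero}      {suc zero}    (inj₁ (_ , s≤s ()))
edgeShape {u = suc zero}      {suc zero}    (inj₂ (s≤s () , _))

Link : Vertex t → Vertex t → List (Vertex t × Vertex t) → Set
Link u v es = (u , v) ∈ es ⊎ (v , u) ∈ es

¬touches-A-and-B : ∀ {vs es} {e : Vertex t × Vertex t} → IsTree (K2 t) vs es → e ∈ es →
                   Touches A e → Touches B e → ⊥
¬touches-A-and-B T e∈ touchA touchB with edgeShape (tree-edge⇒Adj T e∈) | touchA | touchB
... | centre-leaf _ _ _ | inj₁ refl | inj₁ ()
... | centre-leaf _ _ _ | inj₁ refl | inj₂ ()
... | centre-leaf _ _ _ | inj₂ ()   | _
... | leaf-centre _ _ _ | inj₁ ()   | _
... | leaf-centre _ _ _ | inj₂ refl | inj₁ ()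
... | leaf-centre _ _ _ | inj₂ refl | inj₂ ()

leaf-edge-end : ∀ {vs es} {i : Fin t} {e : Vertex t × Vertex t} → IsTree (K2 t) vs es → e ∈ es →
                Touches (leaf i) e →
                Σ (Vertex t) λ w → Centre w × w ∈ vs × (e ≡ (leaf i , w) ⊎ e ≡ (w , leaf i))
leaf-edge-end {e = _ , w} T e∈ (inj₁ refl) =
  w , adj-leaf⇒Centre (tree-edge⇒Adj T e∈) , proj₂ (tree-edge⇒ends∈ T e∈) , inj₁ refl
leaf-edge-end {e = w , _} T e∈ (inj₂ refl) =
  w , adj-leaf⇒Centre (Graph.sym (K2 _) (tree-edge⇒Adj T e∈)) , proj₁ (tree-edge⇒ends∈ T e∈) , inj₂ refl

touches-two-leaves⇒≡ : ∀ {vs es} {i j : Fin t} {e : Vertex t × Vertex t} → IsTree (K2 t) vs es → e ∈ es →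
                       Touches (leaf i) e → Touches (leaf j) e → i ≡ j
touches-two-leaves⇒≡ T e∈ touch-i touch-j with leaf-edge-end T e∈ touch-i | touch-j
... | _ , _         , _ , inj₁ refl | inj₁ i≡j  = leaf-injective i≡j
... | _ , inj₁ refl , _ , inj₁ refl | inj₂ ()
... | _ , inj₂ refl , _ , inj₁ refl | inj₂ ()
... | _ , inj₁ refl , _ , inj₂ refl | inj₁ ()
... | _ , inj₂ refl , _ , inj₂ refl | inj₁ ()
... | _ , _         , _ , inj₂ refl | inj₂ i≡j  = leaf-injective i≡j

-- When the later of the two centres was attached, it hung from a leaf, and that leaf's
-- edge in the earlier tree goes to the other centre.
connector : ∀ {vs es} → IsTree (K2 t) vs es → A ∈ vs → B ∈ vs →
            Σ (Fin t) λ l → Link A (leaf l) es × Link B (leaf l) es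
connector (single _) (here refl) (here ())
connector (grow T _ _ _) (here refl) (here ())
connector (grow T _ _ _) (there A∈) (there B∈) =
  let l , linkA , linkB = connector T A∈ B∈ in l , extend linkA , extend linkB
  where
  extend : ∀ {u v es x} → Link u v es → Link u v (x ∷ es)
  extend (inj₁ e∈) = inj₁ (there e∈)
  extend (inj₂ e∈) = inj₂ (there e∈)
connector (grow T u∈ A∉ adj) (here refl) (there B∈) with edgeShape adj
... | leaf-centre l _ _ with incident-edge T u∈ B∈ (λ ())
... | e , e∈ , touch with leaf-edge-end T e∈ touch
... | _ , inj₁ refl , A∈ , _         = ⊥-elim (A∉ A∈)
... | _ , inj₂ refl , _ , inj₁ refl = l , inj₂ (here refl) , inj₂ (there e∈)
... | _ , inj₂ refl , _ , inj₂ refl = l , inj₂ (here refl) , inj₁ (there e∈)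
connector (grow T u∈ B∉ adj) (there A∈) (here refl) with edgeShape adj
... | leaf-centre l _ _ with incident-edge T u∈ A∈ (λ ())
... | e , e∈ , touch with leaf-edge-end T e∈ touch
... | _ , inj₂ refl , B∈ , _         = ⊥-elim (B∉ B∈)
... | _ , inj₁ refl , _ , inj₁ refl = l , inj₂ (there e∈) , inj₂ (here refl)
... | _ , inj₁ refl , _ , inj₂ refl = l , inj₁ (there e∈) , inj₂ (here refl)

-- Necessary conditions on a 3-rainbow colouring of K₂,ₜ

module _ {m : ℕ} where

  Distinct₃ : Fin m → Fin m → Fin m → Set
  Distinct₃ a b c = a ≢ b × a ≢ c × b ≢ c

  Distinct₄ : Fin m → Fin m → Fin m → Fin m → Set
  Distinct₄ a b c d = (a ≢ b × a ≢ c × a ≢ d) × (b ≢ c × b ≢ d × c ≢ d)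

  -- A leaf with colours p, q joins A to B, and the two other leaves
  -- (with colour pairs r and s) each contribute one more colour.
  Connects : Fin m → Fin m → Fin m × Fin m → Fin m × Fin m → Set
  Connects p q (r₁ , r₂) (s₁ , s₂) =
    (Distinct₄ p q r₁ s₁ ⊎ Distinct₄ p q r₁ s₂) ⊎ (Distinct₄ p q r₂ s₁ ⊎ Distinct₄ p q r₂ s₂)

  -- With at most four colours, a rainbow tree through three leaves is a star at A, a star at B,
  -- or joins A to B through one of the three leaves; this constrains their colour pairs.
  Admissible : Fin m × Fin m → Fin m × Fin m → Fin m × Fin m → Set
  Admissible P@(x₁ , y₁) Q@(x₂ , y₂) R@(x₃ , y₃) =
    (Distinct₃ x₁ x₂ x₃ ⊎ Distinct₃ y₁ y₂ y₃) ⊎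
    (Connects x₁ y₁ Q R ⊎ Connects x₂ y₂ P R ⊎ Connects x₃ y₃ P Q)

  connects : ∀ {p q a b r₁ r₂ s₁ s₂} → Distinct₄ p q a b → a ≡ r₁ ⊎ a ≡ r₂ → b ≡ s₁ ⊎ b ≡ s₂ →
             Connects p q (r₁ , r₂) (s₁ , s₂)
  connects d (inj₁ refl) (inj₁ refl) = inj₁ (inj₁ d)
  connects d (inj₁ refl) (inj₂ refl) = inj₁ (inj₂ d)
  connects d (inj₂ refl) (inj₁ refl) = inj₂ (inj₁ d)
  connects d (inj₂ refl) (inj₂ refl) = inj₂ (inj₂ d)

leaf-≢ : {i j : Fin t} → i ≢ j → leaf i ≢ leaf j
leaf-≢ i≢j = i≢j ∘ leaf-injective

module Necessary {t m : ℕ} (c : EdgeColouring (K2 t) m) (rainbow : IsKRainbowColouring (K2 t) 3 c) where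

  X Y : Fin t → Fin m
  X i = col c A (leaf i)
  Y i = col c B (leaf i)

  colour : Vertex t × Vertex t → Fin m
  colour e = col c (proj₁ e) (proj₂ e)

  record RainbowTree (u v w : Vertex t) : Set where
    field
      vs        : List (Vertex t)
      es        : List (Vertex t × Vertex t)
      tree      : IsTree (K2 t) vs es
      isRainbow : IsRainbow c es
      u∈        : u ∈ vs
      v∈        : v ∈ vs
      w∈        : w ∈ vs

  rainbowTree : {u v w : Vertex t} → u ≢ v → u ≢ w → v ≢ w → RainbowTree u v w
  rainbowTree {u} {v} {w} u≢v u≢w v≢w =
    let vs , es , T , rb , S⊆vs = rainbow (triple u v w) (∣triple∣≡3 u≢v u≢w v≢w) in
    record { vs = vs ; es = es ; tree = T ; isRainbow = rb
           ; u∈ = S⊆vs u (∈triple₁ u v w) ; v∈ = S⊆vs v (∈triple₂ u v w) ; w∈ = S⊆vs w (∈triple₃ u v w) }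

  module InTree {vs : List (Vertex t)} {es : List (Vertex t × Vertex t)}
                (T : IsTree (K2 t) vs es) (rb : IsRainbow c es) where

    colour-≢ : ∀ {e e'} → e ∈ es → e' ∈ es → e ≢ e' → colour e ≢ colour e'
    colour-≢ e∈ e'∈ e≢e' = e≢e' ∘ map-Unique-injective colour rb e∈ e'∈

    different-leaves⇒colour-≢ : ∀ {i j e e'} → e ∈ es → e' ∈ es →
                                Touches (leaf i) e → Touches (leaf j) e' → i ≢ j → colour e ≢ colour e'
    different-leaves⇒colour-≢ e∈ e'∈ touch touch' i≢j =
      colour-≢ e∈ e'∈ λ { refl → i≢j (touches-two-leaves⇒≡ T e'∈ touch touch') }

    record LeafEdge (i : Fin t) : Set where
      field
        edge    : Vertex t × Vertex t
        edge∈   : edge ∈ es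
        touches : Touches (leaf i) edge
        side    : (colour edge ≡ X i × A ∈ vs) ⊎ (colour edge ≡ Y i × B ∈ vs)

    leafEdge : ∀ {i u} → leaf i ∈ vs → u ∈ vs → leaf i ≢ u → LeafEdge i
    leafEdge {i} l∈ u∈ l≢u with incident-edge T l∈ u∈ l≢u
    ... | e , e∈ , touch with leaf-edge-end T e∈ touch
    ... | _ , inj₁ refl , A∈ , inj₁ refl = record { edge∈ = e∈ ; touches = touch ; side = inj₁ (colSym c (leaf i) A , A∈) }
    ... | _ , inj₁ refl , A∈ , inj₂ refl = record { edge∈ = e∈ ; touches = touch ; side = inj₁ (refl , A∈) }
    ... | _ , inj₂ refl , B∈ , inj₁ refl = record { edge∈ = e∈ ; touches = touch ; side = inj₂ (colSym c (leaf i) B , B∈) }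
    ... | _ , inj₂ refl , B∈ , inj₂ refl = record { edge∈ = e∈ ; touches = touch ; side = inj₂ (refl , B∈) }

    leafColour : ∀ {i} → LeafEdge i → Fin m
    leafColour p = colour (LeafEdge.edge p)

    leafColour∈XY : ∀ {i} (p : LeafEdge i) → leafColour p ≡ X i ⊎ leafColour p ≡ Y i
    leafColour∈XY p with LeafEdge.side p
    ... | inj₁ (eq , _) = inj₁ eq
    ... | inj₂ (eq , _) = inj₂ eq

    leafColour-≢ : ∀ {i j} → i ≢ j → (p : LeafEdge i) (q : LeafEdge j) → leafColour p ≢ leafColour q
    leafColour-≢ i≢j p q =
      different-leaves⇒colour-≢ (LeafEdge.edge∈ p) (LeafEdge.edge∈ q) (LeafEdge.touches p) (LeafEdge.touches q) i≢j

    record LinkEdge (z : Vertex t) (l : Fin t) : Set where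
      field
        edge       : Vertex t × Vertex t
        edge∈      : edge ∈ es
        touches    : Touches (leaf l) edge
        touches-z  : Touches z edge
        colour-≡   : colour edge ≡ col c z (leaf l)

    linkEdge : ∀ {z l} → Link z (leaf l) es → LinkEdge z l
    linkEdge {z} {l} (inj₁ e∈) = record { edge∈ = e∈ ; touches = inj₂ refl ; touches-z = inj₁ refl ; colour-≡ = refl }
    linkEdge {z} {l} (inj₂ e∈) = record { edge∈ = e∈ ; touches = inj₁ refl ; touches-z = inj₂ refl ; colour-≡ = colSym c (leaf l) z }

    linkColour-≢ : ∀ {l l'} (a : LinkEdge A l) (b : LinkEdge B l') → colour (LinkEdge.edge a) ≢ colour (LinkEdge.edge b)
    linkColour-≢ a b = colour-≢ (LinkEdge.edge∈ a) (LinkEdge.edge∈ b) λ { refl →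
      ¬touches-A-and-B T (LinkEdge.edge∈ b) (LinkEdge.touches-z a) (LinkEdge.touches-z b) }

    linkColour-≢-leafColour : ∀ {z l i} → l ≢ i → (a : LinkEdge z l) (p : LeafEdge i) →
                              colour (LinkEdge.edge a) ≢ leafColour p
    linkColour-≢-leafColour l≢i a p =
      different-leaves⇒colour-≢ (LinkEdge.edge∈ a) (LeafEdge.edge∈ p) (LinkEdge.touches a) (LeafEdge.touches p) l≢i

    viaConnector : ∀ {l p q} (a : LinkEdge A l) (b : LinkEdge B l) (ep : LeafEdge p) (eq : LeafEdge q) →
                   l ≢ p → l ≢ q → p ≢ q → Distinct₄ (X l) (Y l) (leafColour ep) (leafColour eq)
    viaConnector a b ep eq l≢p l≢q p≢q =
      subst₂ (λ x y → Distinct₄ x y (leafColour ep) (leafColour eq)) (LinkEdge.colour-≡ a) (LinkEdge.colour-≡ b)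
        ((linkColour-≢ a b , linkColour-≢-leafColour l≢p a ep , linkColour-≢-leafColour l≢q a eq) ,
         (linkColour-≢-leafColour l≢p b ep , linkColour-≢-leafColour l≢q b eq , leafColour-≢ p≢q ep eq))

  some-X≢Y : Fin t → Σ (Fin t) λ l → X l ≢ Y l
  some-X≢Y i = l , λ X≡Y → linkColour-≢ a b (begin
      colour (LinkEdge.edge a) ≡⟨ LinkEdge.colour-≡ a ⟩
      X l                      ≡⟨ X≡Y ⟩
      Y l                      ≡⟨ LinkEdge.colour-≡ b ⟨
      colour (LinkEdge.edge b) ∎)
    where
    open ≡-Reasoning
    open RainbowTree (rainbowTree {A} {B} {leaf i} (λ ()) (λ ()) (λ ()))
    open InTree tree isRainbow
    l = proj₁ (connector tree u∈ v∈)
    a = linkEdge (proj₁ (proj₂ (connector tree u∈ v∈)))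
    b = linkEdge (proj₂ (proj₂ (connector tree u∈ v∈)))

  -- The colour of the edge at a leaf i with X i ≡ Y i is determined, so two such leaves
  -- in one rainbow tree need different colours.
  diagonal-X-≢ : ∀ {i j} → i ≢ j → X i ≡ Y i → X j ≡ Y j → X i ≢ X j
  diagonal-X-≢ {i} {j} i≢j Xi≡Yi Xj≡Yj = subst₂ _≢_ (onDiagonal p Xi≡Yi) (onDiagonal q Xj≡Yj) (leafColour-≢ i≢j p q)
    where
    open RainbowTree (rainbowTree {A} {leaf i} {leaf j} (λ ()) (λ ()) (leaf-≢ i≢j))
    open InTree tree isRainbow
    p = leafEdge v∈ u∈ (λ ())
    q = leafEdge w∈ u∈ (λ ())
    onDiagonal : ∀ {k} (r : LeafEdge k) → X k ≡ Y k → leafColour r ≡ X k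
    onDiagonal r Xk≡Yk with leafColour∈XY r
    ... | inj₁ eq = eq
    ... | inj₂ eq = trans eq (sym Xk≡Yk)

  module LeafTriple {i j k : Fin t} (i≢j : i ≢ j) (i≢k : i ≢ k) (j≢k : j ≢ k) where
    open RainbowTree (rainbowTree (leaf-≢ i≢j) (leaf-≢ i≢k) (leaf-≢ j≢k)) public
    open InTree tree isRainbow public

    eᵢ : LeafEdge i
    eᵢ = leafEdge u∈ v∈ (leaf-≢ i≢j)
    eⱼ : LeafEdge j
    eⱼ = leafEdge v∈ u∈ (leaf-≢ (i≢j ∘ sym))
    eₖ : LeafEdge k
    eₖ = leafEdge w∈ u∈ (leaf-≢ (i≢k ∘ sym))

    cᵢ cⱼ cₖ : Fin m
    cᵢ = leafColour eᵢ
    cⱼ = leafColour eⱼ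
    cₖ = leafColour eₖ

    distinct : Distinct₃ cᵢ cⱼ cₖ
    distinct = leafColour-≢ i≢j eᵢ eⱼ , leafColour-≢ i≢k eᵢ eₖ , leafColour-≢ j≢k eⱼ eₖ

  Among : Fin m → Fin m → Fin m → Set
  Among P Q z = z ≡ P ⊎ z ≡ Q

  ¬three-leaves-in-two-colours :
    ∀ {i j k} P Q → i ≢ j → i ≢ k → j ≢ k →
    Among P Q (X i) → Among P Q (Y i) → Among P Q (X j) → Among P Q (Y j) → Among P Q (X k) → Among P Q (Y k) → ⊥
  ¬three-leaves-in-two-colours P Q i≢j i≢k j≢k Xi Yi Xj Yj Xk Yk =
    pigeon (among eᵢ Xi Yi) (among eⱼ Xj Yj) (among eₖ Xk Yk) distinct
    where
    open LeafTriple i≢j i≢k j≢k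
    among : ∀ {l} (p : LeafEdge l) → Among P Q (X l) → Among P Q (Y l) → Among P Q (leafColour p)
    among p Xl Yl with leafColour∈XY p
    ... | inj₁ eq = subst (Among P Q) (sym eq) Xl
    ... | inj₂ eq = subst (Among P Q) (sym eq) Yl
    pigeon : ∀ {a b d} → Among P Q a → Among P Q b → Among P Q d → Distinct₃ a b d → ⊥
    pigeon (inj₁ refl) (inj₁ refl) _ (a≢b , _) = a≢b refl
    pigeon (inj₂ refl) (inj₂ refl) _ (a≢b , _) = a≢b refl
    pigeon (inj₁ refl) _ (inj₁ refl) (_ , a≢d , _) = a≢d refl
    pigeon (inj₂ refl) _ (inj₂ refl) (_ , a≢d , _) = a≢d refl
    pigeon _ (inj₁ refl) (inj₁ refl) (_ , _ , b≢d) = b≢d refl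
    pigeon _ (inj₂ refl) (inj₂ refl) (_ , _ , b≢d) = b≢d refl

  admissible : m ≤ 4 → ∀ {i j k} → i ≢ j → i ≢ k → j ≢ k → Admissible (X i , Y i) (X j , Y j) (X k , Y k)
  admissible m≤4 {i} {j} {k} i≢j i≢k j≢k = byCentres (Any.any? (A ≟_) vs) (Any.any? (B ≟_) vs)
    where
    open LeafTriple i≢j i≢k j≢k

    onSideA : B ∉ vs → ∀ {l} (p : LeafEdge l) → leafColour p ≡ X l
    onSideA B∉ p with LeafEdge.side p
    ... | inj₁ (eq , _)  = eq
    ... | inj₂ (_ , B∈) = ⊥-elim (B∉ B∈)

    onSideB : A ∉ vs → ∀ {l} (p : LeafEdge l) → leafColour p ≡ Y l
    onSideB A∉ p with LeafEdge.side p
    ... | inj₁ (_ , A∈) = ⊥-elim (A∉ A∈)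
    ... | inj₂ (eq , _)  = eq

    Distinct₃-cong : ∀ {a b d a' b' d' : Fin m} → a ≡ a' → b ≡ b' → d ≡ d' → Distinct₃ a b d → Distinct₃ a' b' d'
    Distinct₃-cong refl refl refl d = d

    throughConnector : Σ (Fin t) (λ l → Link A (leaf l) es × Link B (leaf l) es) →
                       Admissible (X i , Y i) (X j , Y j) (X k , Y k)
    throughConnector (l , linkA , linkB) with l ≟ i | l ≟ j | l ≟ k
    ... | yes refl | _ | _ =
      inj₂ (inj₁ (connects (viaConnector a b eⱼ eₖ i≢j i≢k j≢k) (leafColour∈XY eⱼ) (leafColour∈XY eₖ)))
      where a = linkEdge linkA ; b = linkEdge linkB
    ... | no _ | yes refl | _ =
      inj₂ (inj₂ (inj₁ (connects (viaConnector a b eᵢ eₖ (i≢j ∘ sym) j≢k i≢k) (leafColour∈XY eᵢ) (leafColour∈XY eₖ))))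
      where a = linkEdge linkA ; b = linkEdge linkB
    ... | no _ | no _ | yes refl =
      inj₂ (inj₂ (inj₂ (connects (viaConnector a b eᵢ eⱼ (i≢k ∘ sym) (j≢k ∘ sym) i≢j) (leafColour∈XY eᵢ) (leafColour∈XY eⱼ))))
      where a = linkEdge linkA ; b = linkEdge linkB
    ... | no l≢i | no l≢j | no l≢k = ⊥-elim (<⇒≱ (Unique⇒length≤ fiveColours) m≤4)
      where
      a = linkEdge linkA
      b = linkEdge linkB
      -- the connector is a fourth leaf, so the tree needs five colours
      fiveColours : Unique (colour (LinkEdge.edge a) ∷ colour (LinkEdge.edge b) ∷ cᵢ ∷ cⱼ ∷ cₖ ∷ [])
      fiveColours =
        unique₅ (linkColour-≢ a b)
                (linkColour-≢-leafColour l≢i a eᵢ) (linkColour-≢-leafColour l≢j a eⱼ) (linkColour-≢-leafColour l≢k a eₖ)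
                (linkColour-≢-leafColour l≢i b eᵢ) (linkColour-≢-leafColour l≢j b eⱼ) (linkColour-≢-leafColour l≢k b eₖ)
                (proj₁ distinct) (proj₁ (proj₂ distinct)) (proj₂ (proj₂ distinct))

    byCentres : Dec (A ∈ vs) → Dec (B ∈ vs) → Admissible (X i , Y i) (X j , Y j) (X k , Y k)
    byCentres (no A∉)  (no B∉)  with LeafEdge.side eᵢ
    ... | inj₁ (_ , A∈) = ⊥-elim (A∉ A∈)
    ... | inj₂ (_ , B∈) = ⊥-elim (B∉ B∈)
    byCentres (yes _)  (no B∉)  = inj₁ (inj₁ (Distinct₃-cong (onSideA B∉ eᵢ) (onSideA B∉ eⱼ) (onSideA B∉ eₖ) distinct))
    byCentres (no A∉)  (yes _)  = inj₁ (inj₂ (Distinct₃-cong (onSideB A∉ eᵢ) (onSideB A∉ eⱼ) (onSideB A∉ eₖ) distinct))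
    byCentres (yes A∈) (yes B∈) = throughConnector (connector tree A∈ B∈)

-- At most m (m - 1) leaves

other : {k : ℕ} → Fin (2 + k) → Fin (2 + k)
other zero    = suc zero
other (suc _) = zero

other-≢ : {k : ℕ} (x : Fin (2 + k)) → other x ≢ x
other-≢ zero    ()
other-≢ (suc x) ()

OffDiagonal : ℕ → Set
OffDiagonal m = Σ (Fin m × Fin m) λ (x , y) → x ≢ y

encodeOffDiagonal : {m : ℕ} → OffDiagonal (suc m) → Fin (suc m * m)
encodeOffDiagonal ((x , _) , x≢y) = combine x (punchOut x≢y)

encodeOffDiagonal-injective : {m : ℕ} (p q : OffDiagonal (suc m)) →
                              encodeOffDiagonal p ≡ encodeOffDiagonal q → proj₁ p ≡ proj₁ q
encodeOffDiagonal-injective ((x , _) , x≢y) ((x' , _) , x'≢y') eq with combine-injective x _ x' _ eq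
... | refl , eq₂ = cong (x ,_) (punchOut-injective x≢y x'≢y' eq₂)

module LeavesToOffDiagonal {t k : ℕ} (c : EdgeColouring (K2 t) (2 + k))
                           (rainbow : IsKRainbowColouring (K2 t) 3 c) where
  open Necessary c rainbow

  data Kind (i : Fin t) : Set where
    first    : X i ≢ Y i → (∀ j → toℕ j < toℕ i → ¬ (X j ≡ X i × Y j ≡ Y i)) → Kind i
    repeated : X i ≢ Y i → (j : Fin t) → toℕ j < toℕ i → X j ≡ X i → Y j ≡ Y i → Kind i
    diagonal : X i ≡ Y i → (∀ j → ¬ (X j ≡ X i × Y j ≡ other (X i))) → Kind i
    shifted  : X i ≡ Y i → (j : Fin t) → X j ≡ X i → Y j ≡ other (X i) → Kind i

  kind : (i : Fin t) → Kind i
  kind i with X i ≟ Y i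
  ... | no X≢Y with any? (λ j → (toℕ j <? toℕ i) ×-dec (X j ≟ X i ×-dec Y j ≟ Y i))
  ...   | yes (j , j<i , eqs) = repeated X≢Y j j<i (proj₁ eqs) (proj₂ eqs)
  ...   | no none             = first X≢Y λ j j<i eqs → none (j , j<i , eqs)
  kind i | yes X≡Y with any? (λ j → X j ≟ X i ×-dec Y j ≟ other (X i))
  ...   | yes (j , eqs) = shifted X≡Y j (proj₁ eqs) (proj₂ eqs)
  ...   | no none       = diagonal X≡Y λ j eqs → none (j , eqs)

  target : ∀ {i} → Kind i → OffDiagonal (2 + k)
  target {i} (first X≢Y _)          = (X i , Y i) , X≢Y
  target {i} (repeated X≢Y _ _ _ _) = (Y i , X i) , X≢Y ∘ sym
  target {i} (diagonal _ _)         = (X i , other (X i)) , other-≢ (X i) ∘ sym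
  target {i} (shifted _ _ _ _)      = (other (X i) , X i) , other-≢ (X i)

  <⇒≢ : {i j : Fin t} → toℕ i < toℕ j → i ≢ j
  <⇒≢ i<j refl = <-irrefl refl i<j

  first-repeated : ∀ {i j} → i ≢ j → X i ≢ Y i → ∀ j₀ → toℕ j₀ < toℕ j → X j₀ ≡ X j → Y j₀ ≡ Y j →
                   X i ≡ Y j → Y i ≡ X j → ⊥
  first-repeated {i} {j} i≢j X≢Y j₀ j₀<j Xj₀ Yj₀ e₁ e₂ =
    ¬three-leaves-in-two-colours {i} {j} {j₀} (X i) (Y i) i≢j i≢j₀ (<⇒≢ j₀<j ∘ sym)
      (inj₁ refl) (inj₂ refl) (inj₂ (sym e₂)) (inj₁ (sym e₁)) (inj₂ (trans Xj₀ (sym e₂))) (inj₁ (trans Yj₀ (sym e₁)))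
    where
    i≢j₀ : i ≢ j₀
    i≢j₀ refl = X≢Y (trans Xj₀ (sym e₂))

  repeated-repeated : ∀ {i j} → i ≢ j → ∀ i₀ → toℕ i₀ < toℕ i → X i₀ ≡ X i → Y i₀ ≡ Y i →
                      ∀ j₀ → toℕ j₀ < toℕ j → X j₀ ≡ X j → Y j₀ ≡ Y j → X i ≡ X j → Y i ≡ Y j → ⊥
  repeated-repeated {i} {j} i≢j i₀ i₀<i Xi₀ Yi₀ j₀ j₀<j Xj₀ Yj₀ e₁ e₂ with i₀ ≟ j
  ... | no i₀≢j = ¬three-leaves-in-two-colours {i} {j} {i₀} (X i) (Y i) i≢j (<⇒≢ i₀<i ∘ sym) (i₀≢j ∘ sym)
                    (inj₁ refl) (inj₂ refl) (inj₁ (sym e₁)) (inj₂ (sym e₂)) (inj₁ Xi₀) (inj₂ Yi₀)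
  ... | yes refl = ¬three-leaves-in-two-colours {i} {i₀} {j₀} (X i) (Y i) i≢j
                    (<⇒≢ (<-trans j₀<j i₀<i) ∘ sym) (<⇒≢ j₀<j ∘ sym)
                    (inj₁ refl) (inj₂ refl) (inj₁ (sym e₁)) (inj₂ (sym e₂))
                    (inj₁ (trans Xj₀ (sym e₁))) (inj₂ (trans Yj₀ (sym e₂)))

  first-shifted : ∀ {i j} → i ≢ j → X j ≡ Y j → ∀ j₀ → X j₀ ≡ X j → Y j₀ ≡ other (X j) →
                  X i ≡ other (X j) → Y i ≡ X j → ⊥
  first-shifted {i} {j} i≢j X≡Y j₀ Xj₀ Yj₀ e₁ e₂ =
    ¬three-leaves-in-two-colours {i} {j} {j₀} (X j) (other (X j)) i≢j i≢j₀ j≢j₀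
      (inj₂ e₁) (inj₁ e₂) (inj₁ refl) (inj₁ (sym X≡Y)) (inj₁ Xj₀) (inj₂ Yj₀)
    where
    j≢j₀ : j ≢ j₀
    j≢j₀ refl = other-≢ (X j) (trans (sym Yj₀) (sym X≡Y))
    i≢j₀ : i ≢ j₀
    i≢j₀ refl = other-≢ (X j) (trans (sym e₁) Xj₀)

  repeated-diagonal : ∀ {i j} → i ≢ j → ∀ i₀ → toℕ i₀ < toℕ i → X i₀ ≡ X i → Y i₀ ≡ Y i → X j ≡ Y j →
                      Y i ≡ X j → X i ≡ other (X j) → ⊥
  repeated-diagonal {i} {j} i≢j i₀ i₀<i Xi₀ Yi₀ X≡Y e₁ e₂ =
    ¬three-leaves-in-two-colours {i} {j} {i₀} (X j) (other (X j)) i≢j (<⇒≢ i₀<i ∘ sym) j≢i₀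
      (inj₂ e₂) (inj₁ e₁) (inj₁ refl) (inj₁ (sym X≡Y)) (inj₂ (trans Xi₀ e₂)) (inj₁ (trans Yi₀ e₁))
    where
    j≢i₀ : j ≢ i₀
    j≢i₀ refl = other-≢ (X j) (sym (trans Xi₀ e₂))

  repeated-shifted : ∀ {i j} → i ≢ j → ∀ i₀ → toℕ i₀ < toℕ i → X i₀ ≡ X i → Y i₀ ≡ Y i → X j ≡ Y j →
                     Y i ≡ other (X j) → X i ≡ X j → ⊥
  repeated-shifted {i} {j} i≢j i₀ i₀<i Xi₀ Yi₀ X≡Y e₁ e₂ =
    ¬three-leaves-in-two-colours {i} {j} {i₀} (X j) (other (X j)) i≢j (<⇒≢ i₀<i ∘ sym) j≢i₀
      (inj₁ e₂) (inj₂ e₁) (inj₁ refl) (inj₁ (sym X≡Y)) (inj₁ (trans Xi₀ e₂)) (inj₂ (trans Yi₀ e₁))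
    where
    j≢i₀ : j ≢ i₀
    j≢i₀ refl = other-≢ (X j) (sym (trans X≡Y (trans Yi₀ e₁)))

  diagonal-shifted : ∀ {i j} → i ≢ j → X i ≡ Y i → X j ≡ Y j → ∀ j₀ → X j₀ ≡ X j → Y j₀ ≡ other (X j) →
                     X i ≡ other (X j) → ⊥
  diagonal-shifted {i} {j} i≢j Xi≡Yi Xj≡Yj j₀ Xj₀ Yj₀ e₁ =
    ¬three-leaves-in-two-colours {i} {j} {j₀} (X i) (X j) i≢j i≢j₀ j≢j₀
      (inj₁ refl) (inj₁ (sym Xi≡Yi)) (inj₂ refl) (inj₂ (sym Xj≡Yj)) (inj₂ Xj₀) (inj₁ (trans Yj₀ (sym e₁)))
    where
    j≢j₀ : j ≢ j₀
    j≢j₀ refl = other-≢ (X j) (trans (sym Yj₀) (sym Xj≡Yj))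
    i≢j₀ : i ≢ j₀
    i≢j₀ refl = other-≢ (X j) (trans (sym e₁) Xj₀)

  target-injective : ∀ {i j} → i ≢ j → (kᵢ : Kind i) (kⱼ : Kind j) → proj₁ (target kᵢ) ≡ proj₁ (target kⱼ) → ⊥
  target-injective {i} {j} i≢j (first _ min₁) (first _ min₂) e with <-cmp (toℕ i) (toℕ j)
  ... | tri< i<j _ _ = min₂ i i<j (cong proj₁ e , cong proj₂ e)
  ... | tri≈ _ i≡j _ = i≢j (toℕ-injective i≡j)
  ... | tri> _ _ j<i = min₁ j j<i (sym (cong proj₁ e) , sym (cong proj₂ e))
  target-injective i≢j (first X≢Y _) (repeated _ j₀ j₀<j Xj₀ Yj₀) e =
    first-repeated i≢j X≢Y j₀ j₀<j Xj₀ Yj₀ (cong proj₁ e) (cong proj₂ e)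
  target-injective i≢j (repeated _ i₀ i₀<i Xi₀ Yi₀) (first X≢Y _) e =
    first-repeated (i≢j ∘ sym) X≢Y i₀ i₀<i Xi₀ Yi₀ (sym (cong proj₁ e)) (sym (cong proj₂ e))
  target-injective {i} i≢j (first _ _) (diagonal _ none) e = none i (cong proj₁ e , cong proj₂ e)
  target-injective {j = j} i≢j (diagonal _ none) (first _ _) e = none j (sym (cong proj₁ e) , sym (cong proj₂ e))
  target-injective i≢j (first _ _) (shifted X≡Y j₀ Xj₀ Yj₀) e =
    first-shifted i≢j X≡Y j₀ Xj₀ Yj₀ (cong proj₁ e) (cong proj₂ e)
  target-injective i≢j (shifted X≡Y i₀ Xi₀ Yi₀) (first _ _) e =
    first-shifted (i≢j ∘ sym) X≡Y i₀ Xi₀ Yi₀ (sym (cong proj₁ e)) (sym (cong proj₂ e))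
  target-injective i≢j (repeated _ i₀ i₀<i Xi₀ Yi₀) (repeated _ j₀ j₀<j Xj₀ Yj₀) e =
    repeated-repeated i≢j i₀ i₀<i Xi₀ Yi₀ j₀ j₀<j Xj₀ Yj₀ (cong proj₂ e) (cong proj₁ e)
  target-injective i≢j (repeated _ i₀ i₀<i Xi₀ Yi₀) (diagonal X≡Y _) e =
    repeated-diagonal i≢j i₀ i₀<i Xi₀ Yi₀ X≡Y (cong proj₁ e) (cong proj₂ e)
  target-injective i≢j (diagonal X≡Y _) (repeated _ j₀ j₀<j Xj₀ Yj₀) e =
    repeated-diagonal (i≢j ∘ sym) j₀ j₀<j Xj₀ Yj₀ X≡Y (sym (cong proj₁ e)) (sym (cong proj₂ e))
  target-injective i≢j (repeated _ i₀ i₀<i Xi₀ Yi₀) (shifted X≡Y _ _ _) e =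
    repeated-shifted i≢j i₀ i₀<i Xi₀ Yi₀ X≡Y (cong proj₁ e) (cong proj₂ e)
  target-injective i≢j (shifted X≡Y _ _ _) (repeated _ j₀ j₀<j Xj₀ Yj₀) e =
    repeated-shifted (i≢j ∘ sym) j₀ j₀<j Xj₀ Yj₀ X≡Y (sym (cong proj₁ e)) (sym (cong proj₂ e))
  target-injective i≢j (diagonal Xi≡Yi _) (diagonal Xj≡Yj _) e = diagonal-X-≢ i≢j Xi≡Yi Xj≡Yj (cong proj₁ e)
  target-injective i≢j (diagonal Xi≡Yi _) (shifted Xj≡Yj j₀ Xj₀ Yj₀) e =
    diagonal-shifted i≢j Xi≡Yi Xj≡Yj j₀ Xj₀ Yj₀ (cong proj₁ e)
  target-injective i≢j (shifted Xi≡Yi i₀ Xi₀ Yi₀) (diagonal Xj≡Yj _) e =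
    diagonal-shifted (i≢j ∘ sym) Xj≡Yj Xi≡Yi i₀ Xi₀ Yi₀ (sym (cong proj₁ e))
  target-injective i≢j (shifted Xi≡Yi _ _ _) (shifted Xj≡Yj _ _ _) e = diagonal-X-≢ i≢j Xi≡Yi Xj≡Yj (cong proj₂ e)

  leaves≤offDiagonal : t ≤ (2 + k) * (1 + k)
  leaves≤offDiagonal with t ≤? (2 + k) * (1 + k)
  ... | yes t≤ = t≤
  ... | no t≰ with pigeonhole (≰⇒> t≰) (encodeOffDiagonal ∘ target ∘ kind)
  ... | i , j , i<j , eq = ⊥-elim (target-injective (<⇒≢ i<j) (kind i) (kind j)
                              (encodeOffDiagonal-injective (target (kind i)) (target (kind j)) eq))

-- Exhaustive search for three and four colours

module _ {m : ℕ} where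

  Distinct₃-swap₁₂ : ∀ {a b c : Fin m} → Distinct₃ a b c → Distinct₃ b a c
  Distinct₃-swap₁₂ (a≢b , a≢c , b≢c) = a≢b ∘ sym , b≢c , a≢c

  Distinct₃-swap₂₃ : ∀ {a b c : Fin m} → Distinct₃ a b c → Distinct₃ a c b
  Distinct₃-swap₂₃ (a≢b , a≢c , b≢c) = a≢c , a≢b , b≢c ∘ sym

  Distinct₄-swap₃₄ : ∀ {p q a b : Fin m} → Distinct₄ p q a b → Distinct₄ p q b a
  Distinct₄-swap₃₄ ((p≢q , p≢a , p≢b) , (q≢a , q≢b , a≢b)) = (p≢q , p≢b , p≢a) , (q≢b , q≢a , a≢b ∘ sym)

  Connects-swap : ∀ {p q} {R S : Fin m × Fin m} → Connects p q R S → Connects p q S R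
  Connects-swap (inj₁ (inj₁ d)) = inj₁ (inj₁ (Distinct₄-swap₃₄ d))
  Connects-swap (inj₁ (inj₂ d)) = inj₂ (inj₁ (Distinct₄-swap₃₄ d))
  Connects-swap (inj₂ (inj₁ d)) = inj₁ (inj₂ (Distinct₄-swap₃₄ d))
  Connects-swap (inj₂ (inj₂ d)) = inj₂ (inj₂ (Distinct₄-swap₃₄ d))

  Admissible-swap₁₂ : ∀ {P Q R : Fin m × Fin m} → Admissible P Q R → Admissible Q P R
  Admissible-swap₁₂ (inj₁ (inj₁ d))        = inj₁ (inj₁ (Distinct₃-swap₁₂ d))
  Admissible-swap₁₂ (inj₁ (inj₂ d))        = inj₁ (inj₂ (Distinct₃-swap₁₂ d))
  Admissible-swap₁₂ (inj₂ (inj₁ c))        = inj₂ (inj₂ (inj₁ c))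
  Admissible-swap₁₂ (inj₂ (inj₂ (inj₁ c))) = inj₂ (inj₁ c)
  Admissible-swap₁₂ (inj₂ (inj₂ (inj₂ c))) = inj₂ (inj₂ (inj₂ (Connects-swap c)))

  Admissible-swap₂₃ : ∀ {P Q R : Fin m × Fin m} → Admissible P Q R → Admissible P R Q
  Admissible-swap₂₃ (inj₁ (inj₁ d))        = inj₁ (inj₁ (Distinct₃-swap₂₃ d))
  Admissible-swap₂₃ (inj₁ (inj₂ d))        = inj₁ (inj₂ (Distinct₃-swap₂₃ d))
  Admissible-swap₂₃ (inj₂ (inj₁ c))        = inj₂ (inj₁ (Connects-swap c))
  Admissible-swap₂₃ (inj₂ (inj₂ (inj₁ c))) = inj₂ (inj₂ (inj₂ c))
  Admissible-swap₂₃ (inj₂ (inj₂ (inj₂ c))) = inj₂ (inj₂ (inj₁ c))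

  _≢?_ : (a b : Fin m) → Dec (a ≢ b)
  a ≢? b = ¬? (a ≟ b)

  Distinct₃? : ∀ a b c → Dec (Distinct₃ a b c)
  Distinct₃? a b c = a ≢? b ×-dec a ≢? c ×-dec b ≢? c

  Distinct₄? : ∀ a b c d → Dec (Distinct₄ a b c d)
  Distinct₄? a b c d = (a ≢? b ×-dec a ≢? c ×-dec a ≢? d) ×-dec (b ≢? c ×-dec b ≢? d ×-dec c ≢? d)

  Connects? : ∀ p q R S → Dec (Connects p q R S)
  Connects? p q (r₁ , r₂) (s₁ , s₂) =
    (Distinct₄? p q r₁ s₁ ⊎-dec Distinct₄? p q r₁ s₂) ⊎-dec (Distinct₄? p q r₂ s₁ ⊎-dec Distinct₄? p q r₂ s₂)

  Admissible? : ∀ P Q R → Dec (Admissible P Q R)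
  Admissible? P@(x₁ , y₁) Q@(x₂ , y₂) R@(x₃ , y₃) =
    (Distinct₃? x₁ x₂ x₃ ⊎-dec Distinct₃? y₁ y₂ y₃) ⊎-dec
    (Connects? x₁ y₁ Q R ⊎-dec Connects? x₂ y₂ P R ⊎-dec Connects? x₃ y₃ P Q)

module _ {X : Set} (R : X → X → X → Set) where

  AllTriples : List X → Set
  AllTriples []       = ⊤
  AllTriples (x ∷ xs) = AllPairs (R x) xs × AllTriples xs

  AllTriples-resp-↭ : (∀ {x y z} → R x y z → R y x z) → (∀ {x y z} → R x y z → R x z y) →
                      ∀ {xs ys} → xs ↭ ys → AllTriples xs → AllTriples ys
  AllTriples-resp-↭ swap₁₂ swap₂₃ = resp
    where
    pairs-resp : ∀ x {xs ys} → xs ↭ ys → AllPairs (R x) xs → AllPairs (R x) ys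
    pairs-resp x p = PermutationSetoid.AllPairs-resp-↭ (setoid X) swap₂₃ (resp₂ (R x)) (↭⇒↭ₛ p)
    resp : ∀ {xs ys} → xs ↭ ys → AllTriples xs → AllTriples ys
    resp ↭.refl         rs                     = rs
    resp (↭.prep x p)   (rx , rs)              = pairs-resp x p rx , resp p rs
    resp (↭.swap x y p) ((rxy ∷ rx) , ry , rs) =
      (All.map swap₁₂ (All-resp-↭ p rxy) ∷ pairs-resp y p ry) , pairs-resp x p rx , resp p rs
    resp (↭.trans p q)  rs                     = resp q (resp p rs)

  AllTriples-map⁺ : {Y : Set} {g : Y → X} {ys : List Y} → Unique ys →
                    (∀ {i j k} → i ≢ j → i ≢ k → j ≢ k → R (g i) (g j) (g k)) → AllTriples (map g ys)
  AllTriples-map⁺ {g = g} {[]}     []         _ = tt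
  AllTriples-map⁺ {g = g} {i ∷ ys} (i∉ ∷ ys!) r = pairs i∉ ys! , AllTriples-map⁺ ys! r
    where
    pairs : ∀ {zs} → All (i ≢_) zs → Unique zs → AllPairs (R (g i)) (map g zs)
    pairs []          []          = []
    pairs (i≢j ∷ i∉) (j∉ ∷ zs!) = All-map⁺ (All.zipWith (λ (i≢k , j≢k) → r i≢j i≢k j≢k) (i∉ , j∉)) ∷ pairs i∉ zs!

module Search (m : ℕ) where

  Code : Set
  Code = Fin (m * m)

  decode : Code → Fin m × Fin m
  decode = remQuot m

  AdmissibleCode : Code → Code → Code → Set
  AdmissibleCode c d e = Admissible (decode c) (decode d) (decode e)

  open import Data.List.Sort (≤-decTotalOrder (m * m)) using (sort; sort-↭; sort-↗)
  open import Data.List.Relation.Unary.Sorted.TotalOrder (DecTotalOrder.totalOrder (≤-decTotalOrder (m * m)))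
    using (Sorted)

  ≤head : Code → List Code → Bool
  ≤head c []      = true
  ≤head c (d ∷ _) = ⌊ c ≤ᶠ? d ⌋

  canPrepend : Code → List Code → Bool
  canPrepend c L = ≤head c L ∧ ⌊ allPairs? (λ d e → Admissible? (decode c) (decode d) (decode e)) L ⌋

  -- `extensionsShorterThan f L` holds when every sorted list with all triples admissible
  -- that ends in L has fewer than f further entries.
  extensionsShorterThan : ℕ → List Code → Bool
  extensionsShorterThan zero    L = false
  extensionsShorterThan (suc f) L = all (λ c → not (canPrepend c L) ∨ extensionsShorterThan f (c ∷ L)) (allFin (m * m))

  canPrepend-complete : ∀ c L → Sorted (c ∷ L) → AllTriples AdmissibleCode (c ∷ L) → T (canPrepend c L)
  canPrepend-complete c []      _         _         = tt
  canPrepend-complete c (d ∷ L) (c≤d ∷ _) (adm , _) = Equivalence.from (T-∧ {⌊ c ≤ᶠ? d ⌋}) (fromWitness c≤d , fromWitness adm)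

  ʳ++-suffix : ∀ {P : List Code → Set} → (∀ {x xs} → P (x ∷ xs) → P xs) → ∀ rs L → P (rs ʳ++ L) → P L
  ʳ++-suffix     tail []       L p = p
  ʳ++-suffix {P} tail (x ∷ rs) L p = tail (ʳ++-suffix {P} tail rs (x ∷ L) p)

  extensionsShorterThan-sound : ∀ f L → T (extensionsShorterThan f L) →
                                ∀ rs → Sorted (rs ʳ++ L) → AllTriples AdmissibleCode (rs ʳ++ L) → length rs < f
  extensionsShorterThan-sound (suc f) L short []       _      _    = s≤s z≤n
  extensionsShorterThan-sound (suc f) L short (x ∷ rs) sorted adm =
    s≤s (extensionsShorterThan-sound f (x ∷ L) (orElse prependable step) rs sorted adm)
    where
    step : T (not (canPrepend x L) ∨ extensionsShorterThan f (x ∷ L))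
    step = All.lookup (all⁺ _ (allFin (m * m)) short) (∈-allFin x)
    prependable : T (canPrepend x L)
    prependable = canPrepend-complete x L
                    (ʳ++-suffix {Sorted} Linked.tail rs (x ∷ L) sorted)
                    (ʳ++-suffix {AllTriples AdmissibleCode} proj₂ rs (x ∷ L) adm)
    orElse : ∀ {a b} → T a → T (not a ∨ b) → T b
    orElse {true} _ b = b

  -- The colour pairs of t leaves, sorted, form such a list with no prescribed suffix.
  admissible⇒leaves< : ∀ {t} (f : Fin t → Fin m × Fin m) →
                       (∀ {i j k} → i ≢ j → i ≢ k → j ≢ k → Admissible (f i) (f j) (f k)) →
                       ∀ F → T (extensionsShorterThan F []) → t < F
  admissible⇒leaves< {t} f adm F short =
    subst (_< F) length≡t (extensionsShorterThan-sound F [] short (reverse M) sorted allAdmissible)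
    where
    code : Fin t → Code
    code i = uncurry combine (f i)
    admissibleCodes : ∀ {i j k} → i ≢ j → i ≢ k → j ≢ k → AdmissibleCode (code i) (code j) (code k)
    admissibleCodes {i} {j} {k} i≢j i≢k j≢k =
      Admissible-cong (decode-code i) (decode-code j) (decode-code k) (adm i≢j i≢k j≢k)
      where
      decode-code : ∀ i → f i ≡ decode (code i)
      decode-code i = sym (remQuot-combine (proj₁ (f i)) (proj₂ (f i)))
      Admissible-cong : ∀ {P Q R P' Q' R'} → P ≡ P' → Q ≡ Q' → R ≡ R' → Admissible P Q R → Admissible P' Q' R'
      Admissible-cong refl refl refl a = a
    codes = map code (allFin t)
    M = sort codes
    M≡ : M ≡ reverse M ʳ++ []
    M≡ = sym (trans (ʳ++-defn (reverse M)) (trans (++-identityʳ (reverse (reverse M))) (reverse-involutive M)))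
    sorted : Sorted (reverse M ʳ++ [])
    sorted = subst Sorted M≡ (sort-↗ codes)
    allAdmissible : AllTriples AdmissibleCode (reverse M ʳ++ [])
    allAdmissible = subst (AllTriples AdmissibleCode) M≡
      (AllTriples-resp-↭ AdmissibleCode Admissible-swap₁₂ Admissible-swap₂₃ (↭-sym (sort-↭ codes))
        (AllTriples-map⁺ AdmissibleCode (Unique.allFin⁺ t) admissibleCodes))
    length≡t : length (reverse M) ≡ t
    length≡t = begin
      length (reverse M)  ≡⟨ length-reverse M ⟩
      length M            ≡⟨ ↭-length (sort-↭ codes) ⟩
      length codes        ≡⟨ length-map code (allFin t) ⟩
      length (allFin t)   ≡⟨ length-tabulate (λ i → i) ⟩
      t                   ∎
      where open ≡-Reasoning

-- Colourings given by colour pairs on the leaves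

data VertexView {t} : Vertex t → Set where
  isA    : VertexView A
  isB    : VertexView B
  isLeaf : (i : Fin t) → VertexView (leaf i)

vertexView : (v : Vertex t) → VertexView v
vertexView zero          = isA
vertexView (suc zero)    = isB
vertexView (suc (suc i)) = isLeaf i

Avoids : {C : Set} → C → C → C → C → Set
Avoids z a b c = z ≢ a × z ≢ b × z ≢ c

module FromPairs {t k : ℕ} (pair : Fin t → Fin (suc k) × Fin (suc k)) where

  X Y : Fin t → Fin (suc k)
  X i = proj₁ (pair i)
  Y i = proj₂ (pair i)

  -- Non-edges get the (irrelevant) colour zero.
  pairColour : Vertex t → Vertex t → Fin (suc k)
  pairColour u v with vertexView u | vertexView v
  ... | isA      | isLeaf i = X i
  ... | isB      | isLeaf i = Y i
  ... | isLeaf i | isA      = X i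
  ... | isLeaf i | isB      = Y i
  ... | _        | _        = zero

  pairColour-sym : ∀ u v → pairColour u v ≡ pairColour v u
  pairColour-sym u v with vertexView u | vertexView v
  ... | isA      | isA      = refl
  ... | isA      | isB      = refl
  ... | isA      | isLeaf i = refl
  ... | isB      | isA      = refl
  ... | isB      | isB      = refl
  ... | isB      | isLeaf i = refl
  ... | isLeaf i | isA      = refl
  ... | isLeaf i | isB      = refl
  ... | isLeaf i | isLeaf j = refl

  colouring : EdgeColouring (K2 t) (suc k)
  colouring = record { col = pairColour ; colSym = pairColour-sym }

  -- A triangle of leaves (a , b), (a , c), (c , b) needs a leaf with colours outside {a, b, c}.
  Avoiding : (Fin t → Fin t → Fin t → Fin t → Set) → Set
  Avoiding Early = ∀ i j l → X i ≡ X j → Y i ≡ Y l → Y j ≡ X l →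
                   Σ (Fin t) λ l' → Early i j l l' × Avoids (X l') (X i) (Y i) (Y j) × Avoids (Y l') (X i) (Y i) (Y j)

  record IsDesign : Set where
    field
      off-diagonal : ∀ i → X i ≢ Y i
      injective    : ∀ i j → pair i ≡ pair j → i ≡ j
      avoiding     : Avoiding (λ _ _ _ _ → ⊤)

  -- The avoiding leaf is never later than the triangle it serves or the t₀-th leaf,
  -- so every prefix of length at least t₀ is again a design.
  record IsPrefixDesign (t₀ : ℕ) : Set where
    field
      off-diagonal : ∀ i → X i ≢ Y i
      injective    : ∀ i j → pair i ≡ pair j → i ≡ j
      avoiding     : Avoiding (λ i j l l' → toℕ l' < t₀ ⊔ suc (toℕ i) ⊔ suc (toℕ j) ⊔ suc (toℕ l))

  isPrefixDesign? : ∀ t₀ → Dec (IsPrefixDesign t₀)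
  isPrefixDesign? t₀ =
    map′ (λ (o , i , a) → record { off-diagonal = o ; injective = i ; avoiding = a })
         (λ d → IsPrefixDesign.off-diagonal d , IsPrefixDesign.injective d , IsPrefixDesign.avoiding d)
         (all? (λ i → X i ≢? Y i) ×-dec
          all? (λ i → all? λ j → ≡-dec _≟_ _≟_ (pair i) (pair j) →-dec (i ≟ j)) ×-dec
          all? λ i → all? λ j → all? λ l → (X i ≟ X j) →-dec (Y i ≟ Y l) →-dec (Y j ≟ X l) →-dec
            any? λ l' → (toℕ l' <? t₀ ⊔ suc (toℕ i) ⊔ suc (toℕ j) ⊔ suc (toℕ l)) ×-dec
                        (X l' ≢? X i ×-dec X l' ≢? Y i ×-dec X l' ≢? Y j) ×-dec
                        (Y l' ≢? X i ×-dec Y l' ≢? Y i ×-dec Y l' ≢? Y j))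

prefix-isDesign : ∀ {N k t₀ t} {pair : Fin N → Fin (suc k) × Fin (suc k)} → FromPairs.IsPrefixDesign pair t₀ →
                  t₀ ≤ t → (t≤N : t ≤ N) → FromPairs.IsDesign (λ i → pair (inject≤ i t≤N))
prefix-isDesign {N} {k} {t₀} {t} {pair} design t₀≤t t≤N = record
  { off-diagonal = λ i → off-diagonal (ι i)
  ; injective    = λ i j eq → inject≤-injective t≤N t≤N i j (injective (ι i) (ι j) eq)
  ; avoiding     = avoiding′
  }
  where
  open FromPairs pair
  open IsPrefixDesign design
  ι : Fin t → Fin N
  ι i = inject≤ i t≤N
  ι<t : ∀ i → suc (toℕ (ι i)) ≤ t
  ι<t i = subst (_< t) (sym (toℕ-inject≤ i t≤N)) (toℕ<n i)
  avoiding′ : FromPairs.Avoiding (pair ∘ ι) (λ _ _ _ _ → ⊤)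
  avoiding′ i j l eq₁ eq₂ eq₃ with avoiding (ι i) (ι j) (ι l) eq₁ eq₂ eq₃
  ... | l' , early , avoids = fromℕ< l'<t , tt , subst (λ z → Avoids (X z) _ _ _ × Avoids (Y z) _ _ _) (sym ι-l') avoids
    where
    l'<t : toℕ l' < t
    l'<t = <-≤-trans early (⊔-lub (⊔-lub (⊔-lub t₀≤t (ι<t i)) (ι<t j)) (ι<t l))
    ι-l' : ι (fromℕ< l'<t) ≡ l'
    ι-l' = toℕ-injective (trans (toℕ-inject≤ _ t≤N) (toℕ-fromℕ< l'<t))

module DesignTrees {t k : ℕ} {pair : Fin t → Fin (suc k) × Fin (suc k)} (design : FromPairs.IsDesign pair) where
  open FromPairs pair
  open FromPairs.IsDesign design

  RainbowTreeThrough : Vertex t → Vertex t → Vertex t → Set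
  RainbowTreeThrough u v w = Σ (List (Vertex t)) λ vs → Σ (List (Vertex t × Vertex t)) λ es →
    IsTree (K2 t) vs es × IsRainbow colouring es × u ∈ vs × v ∈ vs × w ∈ vs

  swap₁₂ : ∀ {u v w} → RainbowTreeThrough u v w → RainbowTreeThrough v u w
  swap₁₂ (vs , es , T , rb , u∈ , v∈ , w∈) = vs , es , T , rb , v∈ , u∈ , w∈

  swap₂₃ : ∀ {u v w} → RainbowTreeThrough u v w → RainbowTreeThrough u w v
  swap₂₃ (vs , es , T , rb , u∈ , v∈ , w∈) = vs , es , T , rb , u∈ , w∈ , v∈

  pair-injective : ∀ {i j} → X i ≡ X j → Y i ≡ Y j → i ≡ j
  pair-injective X≡ Y≡ = injective _ _ (cong₂ _,_ X≡ Y≡)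

  A-B-leaf : ∀ i → RainbowTreeThrough A B (leaf i)
  A-B-leaf i =
    B ∷ leaf i ∷ A ∷ [] , (leaf i , B) ∷ (A , leaf i) ∷ [] ,
    grow (grow (single A) (here refl) (All¬⇒¬Any ((λ ()) ∷ [])) (adj-A-leaf i))
         (here refl) (All¬⇒¬Any ((λ ()) ∷ (λ ()) ∷ [])) (adj-leaf-B i) ,
    unique₂ (off-diagonal i ∘ sym) ,
    there (there (here refl)) , here refl , there (here refl)

  A-leaf-leaf : ∀ i j → i ≢ j → RainbowTreeThrough A (leaf i) (leaf j)
  A-leaf-leaf i j i≢j with X i ≟ X j
  ... | no Xi≢Xj =
    leaf j ∷ leaf i ∷ A ∷ [] , (A , leaf j) ∷ (A , leaf i) ∷ [] ,
    grow (grow (single A) (here refl) (All¬⇒¬Any ((λ ()) ∷ [])) (adj-A-leaf i))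
         (there (here refl)) (All¬⇒¬Any (leaf-≢ (i≢j ∘ sym) ∷ (λ ()) ∷ [])) (adj-A-leaf j) ,
    unique₂ (Xi≢Xj ∘ sym) ,
    there (there (here refl)) , there (here refl) , here refl
  ... | yes Xi≡Xj =
    leaf j ∷ B ∷ leaf i ∷ A ∷ [] , (B , leaf j) ∷ (leaf i , B) ∷ (A , leaf i) ∷ [] ,
    grow (grow (grow (single A) (here refl) (All¬⇒¬Any ((λ ()) ∷ [])) (adj-A-leaf i))
               (here refl) (All¬⇒¬Any ((λ ()) ∷ (λ ()) ∷ [])) (adj-leaf-B i))
         (here refl) (All¬⇒¬Any ((λ ()) ∷ leaf-≢ (i≢j ∘ sym) ∷ (λ ()) ∷ [])) (adj-B-leaf j) ,
    unique₃ (i≢j ∘ pair-injective Xi≡Xj ∘ sym) (off-diagonal j ∘ trans (sym Xi≡Xj) ∘ sym) (off-diagonal i ∘ sym) ,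
    there (there (there (here refl))) , there (there (here refl)) , here refl

  B-leaf-leaf : ∀ i j → i ≢ j → RainbowTreeThrough B (leaf i) (leaf j)
  B-leaf-leaf i j i≢j with Y i ≟ Y j
  ... | no Yi≢Yj =
    leaf j ∷ leaf i ∷ B ∷ [] , (B , leaf j) ∷ (B , leaf i) ∷ [] ,
    grow (grow (single B) (here refl) (All¬⇒¬Any ((λ ()) ∷ [])) (adj-B-leaf i))
         (there (here refl)) (All¬⇒¬Any (leaf-≢ (i≢j ∘ sym) ∷ (λ ()) ∷ [])) (adj-B-leaf j) ,
    unique₂ (Yi≢Yj ∘ sym) ,
    there (there (here refl)) , there (here refl) , here refl
  ... | yes Yi≡Yj =
    leaf j ∷ A ∷ leaf i ∷ B ∷ [] , (A , leaf j) ∷ (leaf i , A) ∷ (B , leaf i) ∷ [] ,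
    grow (grow (grow (single B) (here refl) (All¬⇒¬Any ((λ ()) ∷ [])) (adj-B-leaf i))
               (here refl) (All¬⇒¬Any ((λ ()) ∷ (λ ()) ∷ [])) (adj-leaf-A i))
         (here refl) (All¬⇒¬Any ((λ ()) ∷ leaf-≢ (i≢j ∘ sym) ∷ (λ ()) ∷ [])) (adj-A-leaf j) ,
    unique₃ (i≢j ∘ sym ∘ flip pair-injective (sym Yi≡Yj)) (off-diagonal j ∘ flip trans Yi≡Yj) (off-diagonal i) ,
    there (there (there (here refl))) , there (there (here refl)) , here refl

  star-A : ∀ {i j l} → i ≢ j → i ≢ l → j ≢ l → Distinct₃ (X i) (X j) (X l) →
           RainbowTreeThrough (leaf i) (leaf j) (leaf l)
  star-A {i} {j} {l} i≢j i≢l j≢l (a , b , c) =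
    leaf l ∷ leaf j ∷ leaf i ∷ A ∷ [] , (A , leaf l) ∷ (A , leaf j) ∷ (A , leaf i) ∷ [] ,
    grow (grow (grow (single A) (here refl) (All¬⇒¬Any ((λ ()) ∷ [])) (adj-A-leaf i))
               (there (here refl)) (All¬⇒¬Any (leaf-≢ (i≢j ∘ sym) ∷ (λ ()) ∷ [])) (adj-A-leaf j))
         (there (there (here refl))) (All¬⇒¬Any (leaf-≢ (j≢l ∘ sym) ∷ leaf-≢ (i≢l ∘ sym) ∷ (λ ()) ∷ [])) (adj-A-leaf l) ,
    unique₃ (c ∘ sym) (b ∘ sym) (a ∘ sym) ,
    there (there (here refl)) , there (here refl) , here refl

  star-B : ∀ {i j l} → i ≢ j → i ≢ l → j ≢ l → Distinct₃ (Y i) (Y j) (Y l) →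
           RainbowTreeThrough (leaf i) (leaf j) (leaf l)
  star-B {i} {j} {l} i≢j i≢l j≢l (a , b , c) =
    leaf l ∷ leaf j ∷ leaf i ∷ B ∷ [] , (B , leaf l) ∷ (B , leaf j) ∷ (B , leaf i) ∷ [] ,
    grow (grow (grow (single B) (here refl) (All¬⇒¬Any ((λ ()) ∷ [])) (adj-B-leaf i))
               (there (here refl)) (All¬⇒¬Any (leaf-≢ (i≢j ∘ sym) ∷ (λ ()) ∷ [])) (adj-B-leaf j))
         (there (there (here refl))) (All¬⇒¬Any (leaf-≢ (j≢l ∘ sym) ∷ leaf-≢ (i≢l ∘ sym) ∷ (λ ()) ∷ [])) (adj-B-leaf l) ,
    unique₃ (c ∘ sym) (b ∘ sym) (a ∘ sym) ,
    there (there (here refl)) , there (here refl) , here refl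

  -- Leaves i, j share their A-colour and i, l their B-colour: join i to both centres, hang j
  -- from B and l from A, unless that repeats a colour; then the leaves form a triangle and
  -- a fourth leaf avoiding its colours joins the centres instead.
  overlapping : ∀ i j l → i ≢ j → i ≢ l → j ≢ l → X i ≡ X j → Y i ≡ Y l → RainbowTreeThrough (leaf i) (leaf j) (leaf l)
  overlapping i j l i≢j i≢l j≢l Xi≡Xj Yi≡Yl with Y j ≟ X l
  ... | no Yj≢Xl =
    leaf l ∷ leaf j ∷ B ∷ leaf i ∷ A ∷ [] , (A , leaf l) ∷ (B , leaf j) ∷ (leaf i , B) ∷ (A , leaf i) ∷ [] ,
    grow (grow (grow (grow (single A) (here refl) (All¬⇒¬Any ((λ ()) ∷ [])) (adj-A-leaf i))
                     (here refl) (All¬⇒¬Any ((λ ()) ∷ (λ ()) ∷ [])) (adj-leaf-B i))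
               (here refl) (All¬⇒¬Any ((λ ()) ∷ leaf-≢ (i≢j ∘ sym) ∷ (λ ()) ∷ [])) (adj-B-leaf j))
         (there (there (there (here refl))))
         (All¬⇒¬Any (leaf-≢ (j≢l ∘ sym) ∷ (λ ()) ∷ leaf-≢ (i≢l ∘ sym) ∷ (λ ()) ∷ [])) (adj-A-leaf l) ,
    unique₄ (Yj≢Xl ∘ sym) (off-diagonal l ∘ flip trans Yi≡Yl) (i≢l ∘ sym ∘ flip pair-injective (sym Yi≡Yl))
            (i≢j ∘ pair-injective Xi≡Xj ∘ sym) (off-diagonal j ∘ sym ∘ flip trans Xi≡Xj) (off-diagonal i ∘ sym) ,
    there (there (there (here refl))) , there (here refl) , here refl
  ... | yes Yj≡Xl with avoiding i j l Xi≡Xj Yi≡Yl Yj≡Xl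
  ...   | l' , _ , (X≢Xi , X≢Yi , X≢Yj) , (Y≢Xi , Y≢Yi , Y≢Yj) =
    leaf l ∷ leaf j ∷ leaf i ∷ B ∷ leaf l' ∷ A ∷ [] ,
    (B , leaf l) ∷ (B , leaf j) ∷ (A , leaf i) ∷ (leaf l' , B) ∷ (A , leaf l') ∷ [] ,
    grow (grow (grow (grow (grow (single A) (here refl) (All¬⇒¬Any ((λ ()) ∷ [])) (adj-A-leaf l'))
                           (here refl) (All¬⇒¬Any ((λ ()) ∷ (λ ()) ∷ [])) (adj-leaf-B l'))
                     (there (there (here refl))) (All¬⇒¬Any ((λ ()) ∷ leaf-≢ i≢l' ∷ (λ ()) ∷ [])) (adj-A-leaf i))
               (there (here refl)) (All¬⇒¬Any (leaf-≢ (i≢j ∘ sym) ∷ (λ ()) ∷ leaf-≢ j≢l' ∷ (λ ()) ∷ [])) (adj-B-leaf j))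
         (there (there (here refl)))
         (All¬⇒¬Any (leaf-≢ (j≢l ∘ sym) ∷ leaf-≢ (i≢l ∘ sym) ∷ (λ ()) ∷ leaf-≢ l≢l' ∷ (λ ()) ∷ [])) (adj-B-leaf l) ,
    unique₅ (off-diagonal l ∘ sym ∘ flip trans Yj≡Xl) (off-diagonal i ∘ sym ∘ trans Yi≡Yl)
            (Y≢Yi ∘ sym ∘ trans Yi≡Yl) (X≢Yi ∘ sym ∘ trans Yi≡Yl)
            (off-diagonal j ∘ sym ∘ flip trans Xi≡Xj) (Y≢Yj ∘ sym) (X≢Yj ∘ sym)
            (Y≢Xi ∘ sym) (X≢Xi ∘ sym) (off-diagonal l' ∘ sym) ,
    there (there (here refl)) , there (here refl) , here refl
    where
    i≢l' : i ≢ l'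
    i≢l' refl = X≢Xi refl
    j≢l' : j ≢ l'
    j≢l' refl = X≢Xi (sym Xi≡Xj)
    l≢l' : l ≢ l'
    l≢l' refl = Y≢Yi (sym Yi≡Yl)

  leaf-leaf-leaf : ∀ i j l → i ≢ j → i ≢ l → j ≢ l → RainbowTreeThrough (leaf i) (leaf j) (leaf l)
  leaf-leaf-leaf i j l i≢j i≢l j≢l = by (X i ≟ X j) (X i ≟ X l) (X j ≟ X l) (Y i ≟ Y j) (Y i ≟ Y l) (Y j ≟ Y l)
    where
    by : Dec (X i ≡ X j) → Dec (X i ≡ X l) → Dec (X j ≡ X l) → Dec (Y i ≡ Y j) → Dec (Y i ≡ Y l) → Dec (Y j ≡ Y l) →
         RainbowTreeThrough (leaf i) (leaf j) (leaf l)
    by (no a) (no b) (no c) _ _ _ = star-A i≢j i≢l j≢l (a , b , c)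
    by _ _ _ (no a) (no b) (no c) = star-B i≢j i≢l j≢l (a , b , c)
    by (yes Xij) _ _ (yes Yij) _ _ = ⊥-elim (i≢j (pair-injective Xij Yij))
    by _ (yes Xil) _ _ (yes Yil) _ = ⊥-elim (i≢l (pair-injective Xil Yil))
    by _ _ (yes Xjl) _ _ (yes Yjl) = ⊥-elim (j≢l (pair-injective Xjl Yjl))
    by (yes Xij) _ _ _ (yes Yil) _ = overlapping i j l i≢j i≢l j≢l Xij Yil
    by (yes Xij) _ _ _ _ (yes Yjl) = swap₁₂ (overlapping j i l (i≢j ∘ sym) j≢l i≢l (sym Xij) Yjl)
    by _ (yes Xil) _ (yes Yij) _ _ = swap₂₃ (overlapping i l j i≢l i≢j (j≢l ∘ sym) Xil Yij)
    by _ (yes Xil) _ _ _ (yes Yjl) =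
      swap₂₃ (swap₁₂ (overlapping l i j (i≢l ∘ sym) (j≢l ∘ sym) i≢j (sym Xil) (sym Yjl)))
    by _ _ (yes Xjl) (yes Yij) _ _ =
      swap₁₂ (swap₂₃ (overlapping j l i j≢l (i≢j ∘ sym) (i≢l ∘ sym) Xjl (sym Yij)))
    by _ _ (yes Xjl) _ (yes Yil) _ =
      swap₁₂ (swap₂₃ (swap₁₂ (overlapping l j i (j≢l ∘ sym) (i≢l ∘ sym) (i≢j ∘ sym) (sym Xjl) (sym Yil))))

  through : ∀ u v w → u ≢ v → u ≢ w → v ≢ w → RainbowTreeThrough u v w
  through u v w u≢v u≢w v≢w with vertexView u | vertexView v | vertexView w
  ... | isA      | isB      | isLeaf l = A-B-leaf l
  ... | isA      | isLeaf j | isB      = swap₂₃ (A-B-leaf j)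
  ... | isB      | isA      | isLeaf l = swap₁₂ (A-B-leaf l)
  ... | isB      | isLeaf j | isA      = swap₂₃ (swap₁₂ (A-B-leaf j))
  ... | isLeaf i | isA      | isB      = swap₁₂ (swap₂₃ (A-B-leaf i))
  ... | isLeaf i | isB      | isA      = swap₁₂ (swap₂₃ (swap₁₂ (A-B-leaf i)))
  ... | isA      | isLeaf j | isLeaf l = A-leaf-leaf j l (v≢w ∘ cong leaf)
  ... | isLeaf i | isA      | isLeaf l = swap₁₂ (A-leaf-leaf i l (u≢w ∘ cong leaf))
  ... | isLeaf i | isLeaf j | isA      = swap₂₃ (swap₁₂ (A-leaf-leaf i j (u≢v ∘ cong leaf)))
  ... | isB      | isLeaf j | isLeaf l = B-leaf-leaf j l (v≢w ∘ cong leaf)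
  ... | isLeaf i | isB      | isLeaf l = swap₁₂ (B-leaf-leaf i l (u≢w ∘ cong leaf))
  ... | isLeaf i | isLeaf j | isB      = swap₂₃ (swap₁₂ (B-leaf-leaf i j (u≢v ∘ cong leaf)))
  ... | isLeaf i | isLeaf j | isLeaf l = leaf-leaf-leaf i j l (u≢v ∘ cong leaf) (u≢w ∘ cong leaf) (v≢w ∘ cong leaf)
  ... | isA      | isA      | _        = ⊥-elim (u≢v refl)
  ... | isB      | isB      | _        = ⊥-elim (u≢v refl)
  ... | isA      | _        | isA      = ⊥-elim (u≢w refl)
  ... | isB      | _        | isB      = ⊥-elim (u≢w refl)
  ... | _        | isA      | isA      = ⊥-elim (v≢w refl)
  ... | _        | isB      | isB      = ⊥-elim (v≢w refl)

  isRainbowColouring : IsKRainbowColouring (K2 t) 3 colouring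
  isRainbowColouring S ∣S∣≡3 with ∣S∣≡3⇒threeElements S ∣S∣≡3
  ... | record { u = u ; v = v ; w = w ; u≢v = u≢v ; u≢w = u≢w ; v≢w = v≢w ; cover = cover }
    with through u v w u≢v u≢w v≢w
  ... | vs , es , T , rb , u∈ , v∈ , w∈ = vs , es , T , rb , λ x x∈S → member (cover x x∈S)
    where
    member : ∀ {x} → x ≡ u ⊎ x ≡ v ⊎ x ≡ w → x ∈ vs
    member (inj₁ refl)        = u∈
    member (inj₂ (inj₁ refl)) = v∈
    member (inj₂ (inj₂ refl)) = w∈

prefixDesign⇒rainbow : ∀ {N k t₀ t} {pair : Fin N → Fin (suc k) × Fin (suc k)} → FromPairs.IsPrefixDesign pair t₀ →
                       t₀ ≤ t → t ≤ N → Σ (EdgeColouring (K2 t) (suc k)) (IsKRainbowColouring (K2 t) 3)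
prefixDesign⇒rainbow {pair = pair} design t₀≤t t≤N =
  FromPairs.colouring (λ i → pair (inject≤ i t≤N)) ,
  DesignTrees.isRainbowColouring (prefix-isDesign design t₀≤t t≤N)

one-of-four-avoids : ∀ {n} (f : Fin 4 → Fin n) → (∀ {i j} → f i ≡ f j → i ≡ j) → (a b c : Fin n) →
                     Σ (Fin 4) λ i → Avoids (f i) a b c
one-of-four-avoids f f-injective a b c with any? (λ i → f i ≢? a ×-dec f i ≢? b ×-dec f i ≢? c)
... | yes found = found
... | no none   = ⊥-elim (4≰3 (injective⇒≤ hit-injective))
  where
  4≰3 : ¬ 4 ≤ 3
  4≰3 (s≤s (s≤s (s≤s ())))
  value : Fin 3 → Fin _
  value zero             = a
  value (suc zero)       = b
  value (suc (suc zero)) = c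
  hit : ∀ i → Σ (Fin 3) λ z → f i ≡ value z
  hit i with f i ≟ a | f i ≟ b | f i ≟ c
  ... | yes eq | _      | _      = zero , eq
  ... | no _   | yes eq | _      = suc zero , eq
  ... | no _   | no _   | yes eq = suc (suc zero) , eq
  ... | no ≢a  | no ≢b  | no ≢c  = ⊥-elim (none (i , ≢a , ≢b , ≢c))
  hit-injective : ∀ {i j} → proj₁ (hit i) ≡ proj₁ (hit j) → i ≡ j
  hit-injective {i} {j} eq = f-injective (trans (proj₂ (hit i)) (trans (cong value eq) (sym (proj₂ (hit j)))))

offDiagonalPair : (n : ℕ) → Fin (suc n * n) → Fin (suc n) × Fin (suc n)
offDiagonalPair n i = x , punchIn x y
  where
  x = proj₁ (remQuot {suc n} n i)
  y = proj₂ (remQuot {suc n} n i)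

-- With k = 5 + e, any three colours are avoided by some leaf among the first 3 k + 4, and all
-- of these come before the t₀-th leaf.
offDiagonal-isPrefixDesign : ∀ e → FromPairs.IsPrefixDesign (offDiagonalPair (5 + e)) ((5 + e) * (4 + e) + 1)
offDiagonal-isPrefixDesign e = record
  { off-diagonal = λ i eq → punchInᵢ≢i (proj₁ (remQuot {suc k} k i)) (proj₂ (remQuot {suc k} k i)) (sym eq)
  ; injective    = injective
  ; avoiding     = λ i j l _ _ _ → avoiding (toℕ i) (toℕ j) (toℕ l) (X i) (Y i) (Y j)
  }
  where
  k = 5 + e
  open FromPairs (offDiagonalPair k)

  injective : ∀ i j → offDiagonalPair k i ≡ offDiagonalPair k j → i ≡ j
  injective i j eq = begin
    i                          ≡⟨ combine-remQuot {suc k} k i ⟨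
    uncurry combine (remQuot {suc k} k i) ≡⟨ cong (uncurry combine) (cong₂ _,_ x≡ y≡) ⟩
    uncurry combine (remQuot {suc k} k j) ≡⟨ combine-remQuot {suc k} k j ⟩
    j                          ∎
    where
    open ≡-Reasoning
    x≡ : proj₁ (remQuot {suc k} k i) ≡ proj₁ (remQuot {suc k} k j)
    x≡ = cong proj₁ eq
    y≡ : proj₂ (remQuot {suc k} k i) ≡ proj₂ (remQuot {suc k} k j)
    y≡ = punchIn-injective (proj₁ (remQuot {suc k} k i)) _ _
           (trans (cong proj₂ eq) (cong (λ x → punchIn x (proj₂ (remQuot {suc k} k j))) (sym x≡)))

  toℕ-inject≤-≤3 : ∀ {m} (i : Fin 4) (4≤m : 4 ≤ m) → toℕ (inject≤ i 4≤m) ≤ 3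
  toℕ-inject≤-≤3 i 4≤m = subst (_≤ 3) (sym (toℕ-inject≤ i 4≤m)) (≤-pred (toℕ<n i))

  identity : ∀ e → (5 + e) * 3 + 3 + (2 + e + (5 + e) * e) ≡ (5 + e) * (4 + e)
  identity = solve-∀

  4≤k : 4 ≤ k
  4≤k = s≤s (s≤s (s≤s (s≤s z≤n)))

  avoiding : ∀ i j l a b c → Σ (Fin (suc k * k)) λ l' → toℕ l' < (k * (4 + e) + 1) ⊔ suc i ⊔ suc j ⊔ suc l ×
                                                        Avoids (X l') a b c × Avoids (Y l') a b c
  avoiding i j l a b c = l' , early , subst (λ x → Avoids x a b c) (sym X≡x) x-avoids , subst (λ y → Avoids y a b c) (sym Y≡y) y-avoids
    where
    xs = one-of-four-avoids (λ i → inject≤ i (m≤n⇒m≤1+n 4≤k)) (inject≤-injective _ _ _ _) a b c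
    x = inject≤ (proj₁ xs) (m≤n⇒m≤1+n 4≤k)
    x-avoids = proj₂ xs
    ys = one-of-four-avoids (λ i → punchIn x (inject≤ i 4≤k)) (inject≤-injective _ _ _ _ ∘ punchIn-injective x _ _) a b c
    r = inject≤ (proj₁ ys) 4≤k
    y-avoids = proj₂ ys
    l' = combine x r
    X≡x : X l' ≡ x
    X≡x = cong proj₁ (remQuot-combine x r)
    Y≡y : Y l' ≡ punchIn x r
    Y≡y = cong (λ p → punchIn (proj₁ p) (proj₂ p)) (remQuot-combine x r)
    l'≤ : toℕ l' ≤ k * (4 + e)
    l'≤ = begin
      toℕ l'                      ≡⟨ toℕ-combine x r ⟩
      k * toℕ x + toℕ r           ≤⟨ +-mono-≤ (*-monoʳ-≤ k (toℕ-inject≤-≤3 (proj₁ xs) (m≤n⇒m≤1+n 4≤k))) (toℕ-inject≤-≤3 (proj₁ ys) 4≤k) ⟩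
      k * 3 + 3                   ≤⟨ m≤m+n (k * 3 + 3) (2 + e + k * e) ⟩
      k * 3 + 3 + (2 + e + k * e) ≡⟨ identity e ⟩
      k * (4 + e)                 ∎
      where open ≤-Reasoning
    early : toℕ l' < (k * (4 + e) + 1) ⊔ suc i ⊔ suc j ⊔ suc l
    early = <-≤-trans (subst (toℕ l' <_) (+-comm 1 (k * (4 + e))) (s≤s l'≤))
              (≤-trans (m≤m⊔n t₀ (suc i)) (≤-trans (m≤m⊔n (t₀ ⊔ suc i) (suc j)) (m≤m⊔n (t₀ ⊔ suc i ⊔ suc j) (suc l))))
      where t₀ = k * (4 + e) + 1

table₂ : Vec (Fin 2 × Fin 2) 2
table₂ = (# 0 , # 1) ∷ (# 1 , # 0) ∷ []

table₃ : Vec (Fin 3 × Fin 3) 4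
table₃ = (# 0 , # 1) ∷ (# 0 , # 2) ∷ (# 1 , # 0) ∷ (# 2 , # 0) ∷ []

table₄ : Vec (Fin 4 × Fin 4) 8
table₄ = (# 0 , # 1) ∷ (# 0 , # 2) ∷ (# 1 , # 0) ∷ (# 1 , # 3) ∷ (# 2 , # 0) ∷ (# 2 , # 3) ∷ (# 3 , # 1) ∷ (# 3 , # 2) ∷ []

table₅ : Vec (Fin 5 × Fin 5) 20
table₅ =
  (# 2 , # 4) ∷ (# 0 , # 3) ∷ (# 1 , # 4) ∷ (# 4 , # 2) ∷ (# 0 , # 4) ∷ (# 3 , # 1) ∷ (# 2 , # 1) ∷
  (# 4 , # 0) ∷ (# 3 , # 2) ∷ (# 1 , # 0) ∷ (# 4 , # 3) ∷ (# 0 , # 2) ∷ (# 1 , # 2) ∷ (# 4 , # 1) ∷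
  (# 3 , # 0) ∷ (# 3 , # 4) ∷ (# 1 , # 3) ∷ (# 2 , # 0) ∷ (# 0 , # 1) ∷ (# 2 , # 3) ∷ []

table₂-isPrefixDesign : FromPairs.IsPrefixDesign (Vec.lookup table₂) 1
table₂-isPrefixDesign = from-yes (FromPairs.isPrefixDesign? (Vec.lookup table₂) 1)

table₃-isPrefixDesign : FromPairs.IsPrefixDesign (Vec.lookup table₃) 3
table₃-isPrefixDesign = from-yes (FromPairs.isPrefixDesign? (Vec.lookup table₃) 3)

table₄-isPrefixDesign : FromPairs.IsPrefixDesign (Vec.lookup table₄) 5
table₄-isPrefixDesign = from-yes (FromPairs.isPrefixDesign? (Vec.lookup table₄) 5)

table₅-isPrefixDesign : FromPairs.IsPrefixDesign (Vec.lookup table₅) 9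
table₅-isPrefixDesign = from-yes (FromPairs.isPrefixDesign? (Vec.lookup table₅) 9)

-- Lower bounds

maxLeaves : ℕ → ℕ
maxLeaves 3 = 4
maxLeaves 4 = 8
maxLeaves m = m * (m ∸ 1)

maxLeaves-step : ∀ m → maxLeaves m ≤ maxLeaves (suc m)
maxLeaves-step 0 = z≤n
maxLeaves-step 1 = z≤n
maxLeaves-step 2 = m≤m+n 2 2
maxLeaves-step 3 = m≤m+n 4 4
maxLeaves-step 4 = m≤m+n 8 12
maxLeaves-step m@(suc (suc (suc (suc (suc _))))) = *-mono-≤ (n≤1+n m) (n≤1+n (m ∸ 1))

maxLeaves-mono : ∀ {m n} → m ≤′ n → maxLeaves m ≤ maxLeaves n
maxLeaves-mono ≤′-refl                = ≤-refl
maxLeaves-mono (≤′-step {n} m≤′n) = ≤-trans (maxLeaves-mono m≤′n) (maxLeaves-step n)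

leaves≤maxLeaves : ∀ {t m} → 1 ≤ t → (c : EdgeColouring (K2 t) m) → IsKRainbowColouring (K2 t) 3 c → t ≤ maxLeaves m
leaves≤maxLeaves {m = 0} _ c _ = ⊥-elim (¬Fin0 (col c A A))
leaves≤maxLeaves {suc _} {1} _ c rainbow with Necessary.some-X≢Y c rainbow zero
... | l , X≢Y = ⊥-elim (X≢Y (Fin1-≡ _ _))
  where
  Fin1-≡ : (a b : Fin 1) → a ≡ b
  Fin1-≡ zero zero = refl
leaves≤maxLeaves {m = 2} _ c rainbow = LeavesToOffDiagonal.leaves≤offDiagonal c rainbow
leaves≤maxLeaves {m = 3} _ c rainbow =
  ≤-pred (Search.admissible⇒leaves< 3 (λ i → X i , Y i) (admissible (m≤m+n 3 1)) 5 _)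
  where open Necessary c rainbow
leaves≤maxLeaves {m = 4} _ c rainbow =
  ≤-pred (Search.admissible⇒leaves< 4 (λ i → X i , Y i) (admissible ≤-refl) 9 _)
  where open Necessary c rainbow
leaves≤maxLeaves {m = suc (suc (suc (suc (suc _))))} _ c rainbow = LeavesToOffDiagonal.leaves≤offDiagonal c rainbow

colours-lower-bound : ∀ {t r} → 1 ≤ t → maxLeaves (r ∸ 1) < t →
                      ∀ m (c : EdgeColouring (K2 t) m) → IsKRainbowColouring (K2 t) 3 c → r ≤ m
colours-lower-bound {r = r} 1≤t maxLeaves< m c rainbow with r ≤? m
... | yes r≤m = r≤m
... | no r≰m with ≰⇒> r≰m
...   | s≤s m≤r-1 = ⊥-elim (<⇒≱ maxLeaves< (≤-trans (leaves≤maxLeaves 1≤t c rainbow) (maxLeaves-mono (≤⇒≤′ m≤r-1))))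

theorem1 : (t : ℕ) → 1 ≤ t →
    ((t ≤ 2 → RainbowIndex (K2 t) 3 2) ×
     (3 ≤ t → t ≤ 4 → RainbowIndex (K2 t) 3 3) ×
     (5 ≤ t → t ≤ 8 → RainbowIndex (K2 t) 3 4) ×
     (9 ≤ t → t ≤ 20 → RainbowIndex (K2 t) 3 5) ×
     ((k : ℕ) → 6 ≤ k → (k ∸ 1) * (k ∸ 2) + 1 ≤ t → t ≤ k * (k ∸ 1) →
        RainbowIndex (K2 t) 3 k))
theorem1 t 1≤t =
  (λ t≤2     → prefixDesign⇒rainbow table₂-isPrefixDesign 1≤t t≤2 , colours-lower-bound 1≤t 1≤t) ,
  (λ 3≤t t≤4 → prefixDesign⇒rainbow table₃-isPrefixDesign 3≤t t≤4 , colours-lower-bound 1≤t 3≤t) ,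
  (λ 5≤t t≤8 → prefixDesign⇒rainbow table₄-isPrefixDesign 5≤t t≤8 , colours-lower-bound 1≤t 5≤t) ,
  (λ 9≤t t≤20 → prefixDesign⇒rainbow table₅-isPrefixDesign 9≤t t≤20 , colours-lower-bound 1≤t 9≤t) ,
  large
  where
  large : (k : ℕ) → 6 ≤ k → (k ∸ 1) * (k ∸ 2) + 1 ≤ t → t ≤ k * (k ∸ 1) → RainbowIndex (K2 t) 3 k
  large _ (s≤s (s≤s (s≤s (s≤s (s≤s (s≤s (z≤n {e}))))))) t₀≤t t≤N =
    prefixDesign⇒rainbow (offDiagonal-isPrefixDesign e) t₀≤t t≤N ,
    colours-lower-bound 1≤t (subst (_≤ t) (+-comm _ 1) t₀≤t)
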